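{- Let $\mathcal{C}$ be a finite coproduct-copy discard rig category. Then: (1) for all objects $X$: $\nabla_X;\mathrm{copy}_X=(\mathrm{copy}_X\oplus\mathrm{copy}_X);\nabla_{X\otimes X}$, $\nabla_X;\mathrm{disc}_X=(\mathrm{disc}_X\oplus\mathrm{disc}_X);\nabla_1$, $¡_X;\mathrm{copy}_X=¡_{X\otimes X}$ and $¡_X;\mathrm{disc}_X=¡_1$; (2) for all objects $X$, $\nabla_X$ and $¡_X$ are deterministic and total, i.e. $\nabla_X;\mathrm{copy}_X=\mathrm{copy}_{X\oplus X};(\nabla_X\otimes\nabla_X)$, $\nabla_X;\mathrm{disc}_X=\mathrm{disc}_{X\oplus X}$, $¡_X;\mathrm{copy}_X=\mathrm{copy}_0;(¡_X\otimes ¡_X)$ and $¡_X;\mathrm{disc}_X=\mathrm{disc}_0$; (3) the category $\mathrm{Map}(\mathcal{C})$ (with the structure restricted from $\mathcal{C}$) is a finite coproduct-finite product rig category.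
   Context: Composition is diagrammatic ($f;g$ = first $f$ then $g$). A rig category is a category with symmetric monoidal structures $(\otimes,1)$ and $(\oplus,0)$ and natural isomorphisms $\delta^l_{X,Y,Z}\colon X\otimes(Y\oplus Z)\to(X\otimes Y)\oplus(X\otimes Z)$, $\delta^r_{X,Y,Z}\colon(X\oplus Y)\otimes Z\to(X\otimes Z)\oplus(Y\otimes Z)$, $\lambda^\bullet_X\colon 0\otimes X\to0$, $\rho^\bullet_X\colon X\otimes 0\to 0$ satisfying Laplaza's coherence axioms; $\lambda^\oplus_X\colon 0\oplus X\to X$ and $\rho^\oplus_X\colon X\oplus 0\to X$ are the unitors of $\oplus$. A finite coproduct (fc) category is a symmetric monoidal category $(\mathcal{C},\oplus,0)$ with, for each $X$, a commutative monoid $(\nabla_X\colon X\oplus X\to X,\ ¡_X\colon 0\to X)$, natural in $X$ and coherent with the monoidal structure (equivalently $\oplus$ is a coproduct, $0$ initial). A copy discard (cd) category is a symmetric monoidal category $(\mathcal{C},\otimes,1)$ with, for each $X$, a cocommutative comonoid $(\mathrm{copy}_X\colon X\to X\otimes X,\ \mathrm{disc}_X\colon X\to 1)$ satisfying the coherence conditions $\mathrm{copy}_{X\otimes Y}=(\mathrm{copy}_X\otimes\mathrm{copy}_Y);(\text{the canonical iso }(X\otimes X)\otimes(Y\otimes Y)\cong(X\otimes Y)\otimes(X\otimes Y))$, $\mathrm{disc}_{X\otimes Y}=(\mathrm{disc}_X\otimes\mathrm{disc}_Y);\lambda_1$, $\mathrm{copy}_1=\lambda_1^{ -1}$, $\mathrm{disc}_1=\mathrm{id}_1$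 (naturality is not required). A finite product (fp) category is a cd category whose comonoids are natural (then $\otimes$ is a categorical product and $1$ terminal). A finite coproduct-copy discard (fc-cd) rig category is a rig category with such monoids and comonoids such that $(\mathcal{C},\oplus,0,\nabla,¡)$ is an fc category, $(\mathcal{C},\otimes,1,\mathrm{copy},\mathrm{disc})$ is a cd category, and $\mathrm{disc}_{X\oplus Y}=(\mathrm{disc}_X\oplus\mathrm{disc}_Y);\nabla_1$ and $\mathrm{copy}_{X\oplus Y}=((\rho^\oplus_X)^{ -1}\oplus(\lambda^\oplus_Y)^{ -1});((\mathrm{copy}_X\oplus ¡_{X\otimes Y})\oplus(¡_{Y\otimes X}\oplus\mathrm{copy}_Y));((\delta^l_{X,X,Y})^{ -1}\oplus(\delta^l_{Y,X,Y})^{ -1});(\delta^r_{X,Y,X\oplus Y})^{ -1}$ for all $X,Y$. A finite coproduct-finite product (fc-fp) rig category is a rig category whose $\oplus$-part is an fc category and whose $\otimes$-part is an fp category. An arrow $f\colon X\to Y$ of a cd category is deterministic if $f;\mathrm{copy}_Y=\mathrm{copy}_X;(f\otimes f)$ and total if $f;\mathrm{disc}_Y=\mathrm{disc}_X$; $\mathrm{Map}(\mathcal{C})$ is the subcategory with all objects and only the deterministic total arrows. -}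

module Defs where

-- Composition is written
-- diagrammatically:  f ⨾ g  = first f then g.

open import Level using (Level; _⊔_) renaming (suc to lsuc)
open import Relation.Binary using (Rel; IsEquivalence)
open import Data.Product using (Σ; _×_; _,_; proj₁; proj₂)

record CatData (o h e : Level) : Set (lsuc (o ⊔ h ⊔ e)) where
  infix  4 _≈_
  infixl 9 _⨾_
  field
    Obj : Set o
    Hom : Obj → Obj → Set h
    _≈_ : ∀ {A B} → Rel (Hom A B) e
    id  : ∀ {A} → Hom A A
    _⨾_ : ∀ {A B D} → Hom A B → Hom B D → Hom A D

record IsCategory {o h e} (C : CatData o h e) : Set (o ⊔ h ⊔ e) where
  open CatData C
  field
    equiv : ∀ {A B} → IsEquivalence (_≈_ {A} {B})
    ⨾-resp : ∀ {A B D} {f f' : Hom A B} {g g' : Hom B D} →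
             f ≈ f' → g ≈ g' → f ⨾ g ≈ f' ⨾ g'
    assoc : ∀ {A B D E} (f : Hom A B) (g : Hom B D) (k : Hom D E) →
            (f ⨾ g) ⨾ k ≈ f ⨾ (g ⨾ k)
    idˡ : ∀ {A B} (f : Hom A B) → id ⨾ f ≈ f
    idʳ : ∀ {A B} (f : Hom A B) → f ⨾ id ≈ f

record SymMonData {o h e} (C : CatData o h e) : Set (o ⊔ h) where
  open CatData C
  infixr 10 _⊗₀_ _⊗₁_
  field
    _⊗₀_ : Obj → Obj → Obj
    _⊗₁_ : ∀ {A B A' B'} → Hom A B → Hom A' B' → Hom (A ⊗₀ A') (B ⊗₀ B')
    I    : Obj
    α    : ∀ A B D → Hom ((A ⊗₀ B) ⊗₀ D) (A ⊗₀ (B ⊗₀ D))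
    α⁻¹  : ∀ A B D → Hom (A ⊗₀ (B ⊗₀ D)) ((A ⊗₀ B) ⊗₀ D)
    lu   : ∀ A → Hom (I ⊗₀ A) A
    lu⁻¹ : ∀ A → Hom A (I ⊗₀ A)
    ru   : ∀ A → Hom (A ⊗₀ I) A
    ru⁻¹ : ∀ A → Hom A (A ⊗₀ I)
    σ    : ∀ A B → Hom (A ⊗₀ B) (B ⊗₀ A)

  ex : ∀ A B D E → Hom ((A ⊗₀ B) ⊗₀ (D ⊗₀ E)) ((A ⊗₀ D) ⊗₀ (B ⊗₀ E))
  ex A B D E =
    α A B (D ⊗₀ E)
    ⨾ (id {A} ⊗₁ ((α⁻¹ B D E ⨾ (σ B D ⊗₁ id {E})) ⨾ α D B E))
    ⨾ α⁻¹ A D (B ⊗₀ E)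

record IsSymMon {o h e} {C : CatData o h e} (M : SymMonData C) : Set (o ⊔ h ⊔ e) where
  open CatData C
  open SymMonData M
  field
    ⊗-resp : ∀ {A B A' B'} {f g : Hom A B} {f' g' : Hom A' B'} →
             f ≈ g → f' ≈ g' → (f ⊗₁ f') ≈ (g ⊗₁ g')
    ⊗-id   : ∀ {A B} → (id {A} ⊗₁ id {B}) ≈ id
    ⊗-comp : ∀ {A B D A' B' D'} (f : Hom A B) (g : Hom B D)
               (f' : Hom A' B') (g' : Hom B' D') →
             ((f ⨾ g) ⊗₁ (f' ⨾ g')) ≈ (f ⊗₁ f') ⨾ (g ⊗₁ g')
    α-nat  : ∀ {A B D A' B' D'} (f : Hom A A') (g : Hom B B') (k : Hom D D') →
             ((f ⊗₁ g) ⊗₁ k) ⨾ α A' B' D' ≈ α A B D ⨾ (f ⊗₁ (g ⊗₁ k))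
    lu-nat : ∀ {A B} (f : Hom A B) → (id {I} ⊗₁ f) ⨾ lu B ≈ lu A ⨾ f
    ru-nat : ∀ {A B} (f : Hom A B) → (f ⊗₁ id {I}) ⨾ ru B ≈ ru A ⨾ f
    σ-nat  : ∀ {A B A' B'} (f : Hom A A') (g : Hom B B') →
             (f ⊗₁ g) ⨾ σ A' B' ≈ σ A B ⨾ (g ⊗₁ f)
    α-iso₁ : ∀ A B D → α A B D ⨾ α⁻¹ A B D ≈ id
    α-iso₂ : ∀ A B D → α⁻¹ A B D ⨾ α A B D ≈ id
    lu-iso₁ : ∀ A → lu A ⨾ lu⁻¹ A ≈ id
    lu-iso₂ : ∀ A → lu⁻¹ A ⨾ lu A ≈ id
    ru-iso₁ : ∀ A → ru A ⨾ ru⁻¹ A ≈ id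
    ru-iso₂ : ∀ A → ru⁻¹ A ⨾ ru A ≈ id
    σ-invol : ∀ A B → σ A B ⨾ σ B A ≈ id
    pentagon : ∀ A B D E →
      (α A B D ⊗₁ id {E}) ⨾ α A (B ⊗₀ D) E ⨾ (id {A} ⊗₁ α B D E)
        ≈ α (A ⊗₀ B) D E ⨾ α A B (D ⊗₀ E)
    triangle : ∀ A B → α A I B ⨾ (id {A} ⊗₁ lu B) ≈ (ru A ⊗₁ id {B})
    hexagon : ∀ A B D →
      α A B D ⨾ σ A (B ⊗₀ D) ⨾ α B D A
        ≈ (σ A B ⊗₁ id {D}) ⨾ α B A D ⨾ (id {B} ⊗₁ σ A D)

record RigData {o h e} (C : CatData o h e) : Set (o ⊔ h) where
  open CatData C
  field
    times : SymMonData C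
    plus  : SymMonData C
  open SymMonData times public
  open SymMonData plus public using ()
    renaming ( _⊗₀_ to _⊕₀_ ; _⊗₁_ to _⊕₁_ ; I to O ; α to α⊕ ; α⁻¹ to α⊕⁻¹
             ; lu to lu⊕ ; lu⁻¹ to lu⊕⁻¹ ; ru to ru⊕ ; ru⁻¹ to ru⊕⁻¹
             ; σ to σ⊕ ; ex to ex⊕ )
  field
    δl   : ∀ A B D → Hom (A ⊗₀ (B ⊕₀ D)) ((A ⊗₀ B) ⊕₀ (A ⊗₀ D))
    δl⁻¹ : ∀ A B D → Hom ((A ⊗₀ B) ⊕₀ (A ⊗₀ D)) (A ⊗₀ (B ⊕₀ D))
    δr   : ∀ A B D → Hom ((A ⊕₀ B) ⊗₀ D) ((A ⊗₀ D) ⊕₀ (B ⊗₀ D))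
    δr⁻¹ : ∀ A B D → Hom ((A ⊗₀ D) ⊕₀ (B ⊗₀ D)) ((A ⊕₀ B) ⊗₀ D)
    λ•   : ∀ A → Hom (O ⊗₀ A) O
    λ•⁻¹ : ∀ A → Hom O (O ⊗₀ A)
    ρ•   : ∀ A → Hom (A ⊗₀ O) O
    ρ•⁻¹ : ∀ A → Hom O (A ⊗₀ O)

record IsRig {o h e} {C : CatData o h e} (R : RigData C) : Set (o ⊔ h ⊔ e) where
  open CatData C
  open RigData R
  field
    isCategory : IsCategory C
    isSymMon⊗  : IsSymMon times
    isSymMon⊕  : IsSymMon plus
    δl-nat : ∀ {A B D A' B' D'} (f : Hom A A') (g : Hom B B') (k : Hom D D') →
             (f ⊗₁ (g ⊕₁ k)) ⨾ δl A' B' D' ≈ δl A B D ⨾ ((f ⊗₁ g) ⊕₁ (f ⊗₁ k))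
    δr-nat : ∀ {A B D A' B' D'} (f : Hom A A') (g : Hom B B') (k : Hom D D') →
             ((f ⊕₁ g) ⊗₁ k) ⨾ δr A' B' D' ≈ δr A B D ⨾ ((f ⊗₁ k) ⊕₁ (g ⊗₁ k))
    λ•-nat : ∀ {A B} (f : Hom A B) → (id {O} ⊗₁ f) ⨾ λ• B ≈ λ• A
    ρ•-nat : ∀ {A B} (f : Hom A B) → (f ⊗₁ id {O}) ⨾ ρ• B ≈ ρ• A
    δl-iso₁ : ∀ A B D → δl A B D ⨾ δl⁻¹ A B D ≈ id
    δl-iso₂ : ∀ A B D → δl⁻¹ A B D ⨾ δl A B D ≈ id
    δr-iso₁ : ∀ A B D → δr A B D ⨾ δr⁻¹ A B D ≈ id
    δr-iso₂ : ∀ A B D → δr⁻¹ A B D ⨾ δr A B D ≈ id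
    λ•-iso₁ : ∀ A → λ• A ⨾ λ•⁻¹ A ≈ id
    λ•-iso₂ : ∀ A → λ•⁻¹ A ⨾ λ• A ≈ id
    ρ•-iso₁ : ∀ A → ρ• A ⨾ ρ•⁻¹ A ≈ id
    ρ•-iso₂ : ∀ A → ρ•⁻¹ A ⨾ ρ• A ≈ id
    laplaza-I : ∀ X Y Z →
      δl X Y Z ⨾ (σ X Y ⊕₁ σ X Z) ≈ σ X (Y ⊕₀ Z) ⨾ δr Y Z X
    laplaza-II : ∀ X Y Z →
      (σ⊕ X Y ⊗₁ id {Z}) ⨾ δr Y X Z ≈ δr X Y Z ⨾ σ⊕ (X ⊗₀ Z) (Y ⊗₀ Z)
    laplaza-III : ∀ X Y Z →
      (id {X} ⊗₁ σ⊕ Y Z) ⨾ δl X Z Y ≈ δl X Y Z ⨾ σ⊕ (X ⊗₀ Y) (X ⊗₀ Z)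
    laplaza-IV : ∀ X Y Z W →
      (α⊕ X Y Z ⊗₁ id {W}) ⨾ δr X (Y ⊕₀ Z) W ⨾ (id {X ⊗₀ W} ⊕₁ δr Y Z W)
        ≈ δr (X ⊕₀ Y) Z W ⨾ (δr X Y W ⊕₁ id {Z ⊗₀ W})
          ⨾ α⊕ (X ⊗₀ W) (Y ⊗₀ W) (Z ⊗₀ W)
    laplaza-V : ∀ X Y Z W →
      (id {X} ⊗₁ α⊕ Y Z W) ⨾ δl X Y (Z ⊕₀ W) ⨾ (id {X ⊗₀ Y} ⊕₁ δl X Z W)
        ≈ δl X (Y ⊕₀ Z) W ⨾ (δl X Y Z ⊕₁ id {X ⊗₀ W})
          ⨾ α⊕ (X ⊗₀ Y) (X ⊗₀ Z) (X ⊗₀ W)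
    laplaza-VI : ∀ X Y Z W →
      α X Y (Z ⊕₀ W) ⨾ (id {X} ⊗₁ δl Y Z W) ⨾ δl X (Y ⊗₀ Z) (Y ⊗₀ W)
        ≈ δl (X ⊗₀ Y) Z W ⨾ (α X Y Z ⊕₁ α X Y W)
    laplaza-VII : ∀ X Y Z W →
      α X (Y ⊕₀ Z) W ⨾ (id {X} ⊗₁ δr Y Z W) ⨾ δl X (Y ⊗₀ W) (Z ⊗₀ W)
        ≈ (δl X Y Z ⊗₁ id {W}) ⨾ δr (X ⊗₀ Y) (X ⊗₀ Z) W ⨾ (α X Y W ⊕₁ α X Z W)
    laplaza-VIII : ∀ X Y Z W →
      (δr X Y Z ⊗₁ id {W}) ⨾ δr (X ⊗₀ Z) (Y ⊗₀ Z) W ⨾ (α X Z W ⊕₁ α Y Z W)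
        ≈ α (X ⊕₀ Y) Z W ⨾ δr X Y (Z ⊗₀ W)
    laplaza-IX : ∀ X Y Z W →
      δl (X ⊕₀ Y) Z W ⨾ (δr X Y Z ⊕₁ δr X Y W)
        ≈ δr X Y (Z ⊕₀ W) ⨾ (δl X Z W ⊕₁ δl Y Z W)
          ⨾ ex⊕ (X ⊗₀ Z) (X ⊗₀ W) (Y ⊗₀ Z) (Y ⊗₀ W)
    laplaza-X : λ• O ≈ ρ• O
    laplaza-XI : ∀ X Y →
      δl O X Y ⨾ (λ• X ⊕₁ λ• Y) ⨾ lu⊕ O ≈ λ• (X ⊕₀ Y)
    laplaza-XII : ∀ X Y →
      δr X Y O ⨾ (ρ• X ⊕₁ ρ• Y) ⨾ lu⊕ O ≈ ρ• (X ⊕₀ Y)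
    laplaza-XIII : λ• I ≈ ru O
    laplaza-XIV : ρ• I ≈ lu O
    laplaza-XV : ∀ X → σ O X ⨾ ρ• X ≈ λ• X
    laplaza-XVI : ∀ X Y →
      α O X Y ⨾ λ• (X ⊗₀ Y) ≈ (λ• X ⊗₁ id {Y}) ⨾ λ• Y
    laplaza-XVII : ∀ X Y →
      α X O Y ⨾ (id {X} ⊗₁ λ• Y) ⨾ ρ• X ≈ (ρ• X ⊗₁ id {Y}) ⨾ λ• Y
    laplaza-XVIII : ∀ X Y →
      α X Y O ⨾ (id {X} ⊗₁ ρ• Y) ⨾ ρ• X ≈ ρ• (X ⊗₀ Y)
    laplaza-XIX : ∀ X Y →
      δl X O Y ⨾ (ρ• X ⊕₁ id {X ⊗₀ Y}) ⨾ lu⊕ (X ⊗₀ Y) ≈ (id {X} ⊗₁ lu⊕ Y)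
    laplaza-XX : ∀ X Y →
      δl X Y O ⨾ (id {X ⊗₀ Y} ⊕₁ ρ• X) ⨾ ru⊕ (X ⊗₀ Y) ≈ (id {X} ⊗₁ ru⊕ Y)
    laplaza-XXI : ∀ X Y →
      δr O X Y ⨾ (λ• Y ⊕₁ id {X ⊗₀ Y}) ⨾ lu⊕ (X ⊗₀ Y) ≈ (lu⊕ X ⊗₁ id {Y})
    laplaza-XXII : ∀ X Y →
      δr X O Y ⨾ (id {X ⊗₀ Y} ⊕₁ λ• Y) ⨾ ru⊕ (X ⊗₀ Y) ≈ (ru⊕ X ⊗₁ id {Y})

record MonoidOps {o h e} {C : CatData o h e} (M : SymMonData C) : Set (o ⊔ h) where
  open CatData C
  open SymMonData M
  field
    ∇ : ∀ X → Hom (X ⊗₀ X) X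
    ¡ : ∀ X → Hom I X

-- (C, ⊕, 0, ∇, ¡) is an fc category  (here M plays the role of ⊕)
record IsFc {o h e} {C : CatData o h e} (M : SymMonData C) (m : MonoidOps M)
       : Set (o ⊔ h ⊔ e) where
  open CatData C
  open SymMonData M
  open MonoidOps m
  field
    isSymMon : IsSymMon M
    ∇-assoc : ∀ X → (∇ X ⊗₁ id {X}) ⨾ ∇ X ≈ α X X X ⨾ (id {X} ⊗₁ ∇ X) ⨾ ∇ X
    ∇-unitˡ : ∀ X → (¡ X ⊗₁ id {X}) ⨾ ∇ X ≈ lu X
    ∇-unitʳ : ∀ X → (id {X} ⊗₁ ¡ X) ⨾ ∇ X ≈ ru X
    ∇-comm  : ∀ X → σ X X ⨾ ∇ X ≈ ∇ X
    ∇-nat   : ∀ {X Y} (f : Hom X Y) → (f ⊗₁ f) ⨾ ∇ Y ≈ ∇ X ⨾ f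
    ¡-nat   : ∀ {X Y} (f : Hom X Y) → ¡ X ⨾ f ≈ ¡ Y
    ∇-⊗     : ∀ X Y → ∇ (X ⊗₀ Y) ≈ ex X Y X Y ⨾ (∇ X ⊗₁ ∇ Y)
    ¡-⊗     : ∀ X Y → ¡ (X ⊗₀ Y) ≈ lu⁻¹ I ⨾ (¡ X ⊗₁ ¡ Y)
    ∇-I     : ∇ I ≈ lu I
    ¡-I     : ¡ I ≈ id

record ComonoidOps {o h e} {C : CatData o h e} (M : SymMonData C) : Set (o ⊔ h) where
  open CatData C
  open SymMonData M
  field
    copy : ∀ X → Hom X (X ⊗₀ X)
    disc : ∀ X → Hom X I

record IsCd {o h e} {C : CatData o h e} (M : SymMonData C) (c : ComonoidOps M)
       : Set (o ⊔ h ⊔ e) where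
  open CatData C
  open SymMonData M
  open ComonoidOps c
  field
    isSymMon : IsSymMon M
    copy-assoc : ∀ X →
      copy X ⨾ (copy X ⊗₁ id {X}) ⨾ α X X X ≈ copy X ⨾ (id {X} ⊗₁ copy X)
    copy-unitˡ : ∀ X → copy X ⨾ (disc X ⊗₁ id {X}) ⨾ lu X ≈ id
    copy-unitʳ : ∀ X → copy X ⨾ (id {X} ⊗₁ disc X) ⨾ ru X ≈ id
    copy-comm  : ∀ X → copy X ⨾ σ X X ≈ copy X
    copy-⊗ : ∀ X Y → copy (X ⊗₀ Y) ≈ (copy X ⊗₁ copy Y) ⨾ ex X X Y Y
    disc-⊗ : ∀ X Y → disc (X ⊗₀ Y) ≈ (disc X ⊗₁ disc Y) ⨾ lu I
    copy-I : copy I ≈ lu⁻¹ I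
    disc-I : disc I ≈ id

record IsFp {o h e} {C : CatData o h e} (M : SymMonData C) (c : ComonoidOps M)
       : Set (o ⊔ h ⊔ e) where
  open CatData C
  open SymMonData M
  open ComonoidOps c
  field
    isCd : IsCd M c
    copy-nat : ∀ {X Y} (f : Hom X Y) → f ⨾ copy Y ≈ copy X ⨾ (f ⊗₁ f)
    disc-nat : ∀ {X Y} (f : Hom X Y) → f ⨾ disc Y ≈ disc X

record RigOps {o h e} (C : CatData o h e) : Set (o ⊔ h) where
  field
    rig   : RigData C
  open RigData rig public
  field
    mon   : MonoidOps plus
    comon : ComonoidOps times
  open MonoidOps mon public
  open ComonoidOps comon public

record IsFcCdRig {o h e} (C : CatData o h e) (R : RigOps C) : Set (o ⊔ h ⊔ e) where
  open CatData C
  open RigOps R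
  field
    isRig : IsRig rig
    isFc  : IsFc plus mon
    isCd  : IsCd times comon
    disc-⊕ : ∀ X Y → disc (X ⊕₀ Y) ≈ (disc X ⊕₁ disc Y) ⨾ ∇ I
    copy-⊕ : ∀ X Y → copy (X ⊕₀ Y) ≈
      (ru⊕⁻¹ X ⊕₁ lu⊕⁻¹ Y)
      ⨾ ((copy X ⊕₁ ¡ (X ⊗₀ Y)) ⊕₁ (¡ (Y ⊗₀ X) ⊕₁ copy Y))
      ⨾ (δl⁻¹ X X Y ⊕₁ δl⁻¹ Y X Y)
      ⨾ δr⁻¹ X Y (X ⊕₀ Y)

record IsFcFpRig {o h e} (C : CatData o h e) (R : RigOps C) : Set (o ⊔ h ⊔ e) where
  open RigOps R
  field
    isRig : IsRig rig
    isFc  : IsFc plus mon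
    isFp  : IsFp times comon

record FcCdRigCategory (o h e : Level) : Set (lsuc (o ⊔ h ⊔ e)) where
  field
    cat : CatData o h e
    ops : RigOps cat
    isFcCdRig : IsFcCdRig cat ops
  open CatData cat public
  open RigOps ops public

module _ {o h e} {C : CatData o h e} (R : RigOps C) where
  open CatData C
  open RigOps R

  Deterministic : ∀ {X Y} → Hom X Y → Set e
  Deterministic {X} {Y} f = f ⨾ copy Y ≈ copy X ⨾ (f ⊗₁ f)

  Total : ∀ {X Y} → Hom X Y → Set e
  Total {X} {Y} f = f ⨾ disc Y ≈ disc X

  IsMap : ∀ {X Y} → Hom X Y → Set e
  IsMap f = Deterministic f × Total f

module Sub {o h e p} (C : CatData o h e)
           (P : ∀ {A B} → CatData.Hom C A B → Set p) where
  open CatData C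

  record CatClosed : Set (o ⊔ h ⊔ p) where
    field
      id-P : ∀ {A} → P (id {A})
      ⨾-P  : ∀ {A B D} {f : Hom A B} {g : Hom B D} → P f → P g → P (f ⨾ g)

  SubCat : CatClosed → CatData o (h ⊔ p) e
  SubCat cl = record
    { Obj = Obj
    ; Hom = λ A B → Σ (Hom A B) P
    ; _≈_ = λ f g → proj₁ f ≈ proj₁ g
    ; id  = id , id-P
    ; _⨾_ = λ f g → (proj₁ f ⨾ proj₁ g) , ⨾-P (proj₂ f) (proj₂ g)
    }
    where open CatClosed cl

  record SymMonClosed (M : SymMonData C) : Set (o ⊔ h ⊔ p) where
    open SymMonData M
    field
      ⊗-P    : ∀ {A B A' B'} {f : Hom A B} {g : Hom A' B'} → P f → P g → P (f ⊗₁ g)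
      α-P    : ∀ A B D → P (α A B D)
      α⁻¹-P  : ∀ A B D → P (α⁻¹ A B D)
      lu-P   : ∀ A → P (lu A)
      lu⁻¹-P : ∀ A → P (lu⁻¹ A)
      ru-P   : ∀ A → P (ru A)
      ru⁻¹-P : ∀ A → P (ru⁻¹ A)
      σ-P    : ∀ A B → P (σ A B)

  restrictSM : (cl : CatClosed) (M : SymMonData C) → SymMonClosed M →
               SymMonData (SubCat cl)
  restrictSM cl M s = record
    { _⊗₀_ = _⊗₀_
    ; _⊗₁_ = λ f g → (proj₁ f ⊗₁ proj₁ g) , ⊗-P (proj₂ f) (proj₂ g)
    ; I    = I
    ; α    = λ A B D → α A B D , α-P A B D
    ; α⁻¹  = λ A B D → α⁻¹ A B D , α⁻¹-P A B D
    ; lu   = λ A → lu A , lu-P A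
    ; lu⁻¹ = λ A → lu⁻¹ A , lu⁻¹-P A
    ; ru   = λ A → ru A , ru-P A
    ; ru⁻¹ = λ A → ru⁻¹ A , ru⁻¹-P A
    ; σ    = λ A B → σ A B , σ-P A B
    }
    where
      open SymMonData M
      open SymMonClosed s

  record RigOpsClosed (R : RigOps C) : Set (o ⊔ h ⊔ p) where
    open RigOps R
    field
      catClosed   : CatClosed
      timesClosed : SymMonClosed times
      plusClosed  : SymMonClosed plus
      δl-P   : ∀ A B D → P (δl A B D)
      δl⁻¹-P : ∀ A B D → P (δl⁻¹ A B D)
      δr-P   : ∀ A B D → P (δr A B D)
      δr⁻¹-P : ∀ A B D → P (δr⁻¹ A B D)
      λ•-P   : ∀ A → P (λ• A)
      λ•⁻¹-P : ∀ A → P (λ•⁻¹ A)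
      ρ•-P   : ∀ A → P (ρ• A)
      ρ•⁻¹-P : ∀ A → P (ρ•⁻¹ A)
      ∇-P    : ∀ A → P (∇ A)
      ¡-P    : ∀ A → P (¡ A)
      copy-P : ∀ A → P (copy A)
      disc-P : ∀ A → P (disc A)

  restrictRigOps : (R : RigOps C) (cl : RigOpsClosed R) →
                   RigOps (SubCat (RigOpsClosed.catClosed cl))
  restrictRigOps R cl = record
    { rig = record
      { times = restrictSM catClosed times timesClosed
      ; plus  = restrictSM catClosed plus plusClosed
      ; δl   = λ A B D → δl A B D , δl-P A B D
      ; δl⁻¹ = λ A B D → δl⁻¹ A B D , δl⁻¹-P A B D
      ; δr   = λ A B D → δr A B D , δr-P A B D
      ; δr⁻¹ = λ A B D → δr⁻¹ A B D , δr⁻¹-P A B D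
      ; λ•   = λ A → λ• A , λ•-P A
      ; λ•⁻¹ = λ A → λ•⁻¹ A , λ•⁻¹-P A
      ; ρ•   = λ A → ρ• A , ρ•-P A
      ; ρ•⁻¹ = λ A → ρ•⁻¹ A , ρ•⁻¹-P A
      }
    ; mon = record { ∇ = λ A → ∇ A , ∇-P A ; ¡ = λ A → ¡ A , ¡-P A }
    ; comon = record { copy = λ A → copy A , copy-P A ; disc = λ A → disc A , disc-P A }
    }
    where
      open RigOps R
      open RigOpsClosed cl

-- Map(C): the wide subcategory of deterministic total arrows, with the
-- structure restricted from C.  "Map(C) with the restricted structure is
-- an fc-fp rig category" means: the deterministic total arrows are closed
-- under all the structure (so that the restriction is defined), and the
-- restricted structure satisfies the fc-fp rig category axioms.

module _ {o h e} (𝒞 : FcCdRigCategory o h e) where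
  open FcCdRigCategory 𝒞

  MapClosed : Set (o ⊔ h ⊔ e)
  MapClosed = Sub.RigOpsClosed cat (IsMap ops) ops

  MapCat : MapClosed → CatData o (h ⊔ e) e
  MapCat cl = Sub.SubCat cat (IsMap ops) (Sub.RigOpsClosed.catClosed cl)

  MapOps : (cl : MapClosed) → RigOps (MapCat cl)
  MapOps cl = Sub.restrictRigOps cat (IsMap ops) ops cl

  MapIsFcFpRig : Set (o ⊔ h ⊔ e)
  MapIsFcFpRig = Σ MapClosed λ cl → IsFcFpRig (MapCat cl) (MapOps cl)

-- Part (1) is naturality of ∇ and ¡. Since 0 is initial, every arrow out of it is
-- deterministic and total. The axiom for copy on X ⊕ Y makes the coproduct injections
-- deterministic, the one for disc makes them total, and as the injections are jointly
-- epic an arrow out of X ⊕ Y is deterministic and total as soon as both of its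
-- restrictions are; this covers ∇, _⊕₁_, the ⊕-coherence isomorphisms and the inverse
-- distributors. For the ⊗-coherence isomorphisms, copy (X ⊗ Y) = (copy X ⊗ copy Y) ⨾ ex
-- reduces determinism to coherence identities for the middle-four interchange ex, which
-- follow from the pentagon and the hexagon. Once Map(C) is closed under all the
-- structure it inherits every law, and copy and disc are natural on Map(C) by definition.

module Submission where

open import Defs
open import Level using (Level)
open import Data.Product using (_×_; _,_; proj₁; proj₂)
open import Relation.Binary using (IsEquivalence; Setoid)
import Relation.Binary.Reasoning.Setoid as SetoidReasoning

module CategoryReasoning {o h e} {C : CatData o h e} (isCategory : IsCategory C) where
  open CatData C
  open IsCategory isCategory

  homSetoid : Obj → Obj → Setoid h e
  homSetoid A B = record { Carrier = Hom A B ; _≈_ = _≈_ ; isEquivalence = equiv }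

  module HomReasoning {A B : Obj} = SetoidReasoning (homSetoid A B)
  open module HomEquivalence {A B : Obj} = Setoid (homSetoid A B) public
    using (refl; sym; trans)

  infixr 2 _∙_
  _∙_ : ∀ {A B} {f g k : Hom A B} → f ≈ g → g ≈ k → f ≈ k
  _∙_ = trans

  infixl 8 _⟩⨾⟨_ _⟩⨾⟨refl
  infixr 3 ▹_
  _⟩⨾⟨_ : ∀ {A B D} {f f' : Hom A B} {g g' : Hom B D} → f ≈ f' → g ≈ g' → f ⨾ g ≈ f' ⨾ g'
  _⟩⨾⟨_ = ⨾-resp
  ▹_ : ∀ {A B D} {f : Hom A B} {g g' : Hom B D} → g ≈ g' → f ⨾ g ≈ f ⨾ g'
  ▹ p = ⨾-resp refl p
  _⟩⨾⟨refl : ∀ {A B D} {f f' : Hom A B} {g : Hom B D} → f ≈ f' → f ⨾ g ≈ f' ⨾ g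
  p ⟩⨾⟨refl = ⨾-resp p refl

  assocʳ : ∀ {A B D E} {f : Hom A B} {g : Hom B D} {k : Hom D E} → (f ⨾ g) ⨾ k ≈ f ⨾ (g ⨾ k)
  assocʳ = assoc _ _ _
  assocˡ : ∀ {A B D E} {f : Hom A B} {g : Hom B D} {k : Hom D E} → f ⨾ (g ⨾ k) ≈ (f ⨾ g) ⨾ k
  assocˡ = sym assocʳ

  cancelʳ : ∀ {A B D} {f : Hom A B} {g : Hom B A} {k : Hom D A} → f ⨾ g ≈ id → (k ⨾ f) ⨾ g ≈ k
  cancelʳ p = assocʳ ∙ ▹ p ∙ idʳ _
  cancelˡ : ∀ {A B D} {f : Hom A B} {g : Hom B A} {k : Hom A D} → f ⨾ g ≈ id → f ⨾ (g ⨾ k) ≈ k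
  cancelˡ p = assocˡ ∙ p ⟩⨾⟨refl ∙ idˡ _

  switchʳ : ∀ {A B D} {f : Hom A B} {g : Hom B D} {g' : Hom D B} {k : Hom A D} →
            g ⨾ g' ≈ id → f ⨾ g ≈ k → f ≈ k ⨾ g'
  switchʳ i p = sym (cancelʳ i) ∙ p ⟩⨾⟨refl
  switchˡ : ∀ {A B D} {f : Hom A B} {g : Hom B D} {f' : Hom B A} {k : Hom A D} →
            f' ⨾ f ≈ id → f ⨾ g ≈ k → g ≈ f' ⨾ k
  switchˡ i p = sym (cancelˡ i) ∙ ▹ p

  inverse-unique : ∀ {A B} {p p' : Hom A B} {q q' : Hom B A} →
                   q ⨾ p ≈ id → p' ⨾ q' ≈ id → p ≈ p' → q ≈ q'
  inverse-unique qp pq' e =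
    sym (idʳ _) ∙ ▹ (sym pq' ∙ sym e ⟩⨾⟨refl) ∙ assocˡ ∙ qp ⟩⨾⟨refl ∙ idˡ _

  invert-square : ∀ {A B A' B'} {a : Hom A A'} {b : Hom B B'} {i : Hom A B} {i⁻¹ : Hom B A}
                    {j : Hom A' B'} {j⁻¹ : Hom B' A'} →
                  i⁻¹ ⨾ i ≈ id → j ⨾ j⁻¹ ≈ id → a ⨾ j ≈ i ⨾ b → b ⨾ j⁻¹ ≈ i⁻¹ ⨾ a
  invert-square ii jj p = switchˡ ii (assocˡ ∙ sym p ⟩⨾⟨refl ∙ cancelʳ jj)

  -- Long composites are kept right-nested with _▸_; prefixₘₙ rewrites the first m
  -- factors of such a composite into n factors.
  infixr 9 _▸_
  _▸_ : ∀ {A B D} → Hom A B → Hom B D → Hom A D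
  f ▸ g = f ⨾ g

  prefix₂₁ : ∀ {A B D E} {f : Hom A B} {g : Hom B D} {x : Hom A D} {r : Hom D E} →
             f ▸ g ≈ x → f ▸ g ▸ r ≈ x ▸ r
  prefix₂₁ p = assocˡ ∙ p ⟩⨾⟨refl
  prefix₂₂ : ∀ {A B D E F} {f : Hom A B} {g : Hom B D} {f' : Hom A F} {g' : Hom F D} {r : Hom D E} →
             f ▸ g ≈ f' ▸ g' → f ▸ g ▸ r ≈ f' ▸ g' ▸ r
  prefix₂₂ p = prefix₂₁ p ∙ assocʳ
  prefix₃₁ : ∀ {A B D E G} {f : Hom A B} {g : Hom B D} {k : Hom D E} {x : Hom A E} {r : Hom E G} →
             f ▸ g ▸ k ≈ x → f ▸ g ▸ k ▸ r ≈ x ▸ r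
  prefix₃₁ p = ▹ assocˡ ∙ prefix₂₁ p
  prefix₃₂ : ∀ {A B D E F G} {f : Hom A B} {g : Hom B D} {k : Hom D E} {x : Hom A F} {y : Hom F E}
               {r : Hom E G} →
             f ▸ g ▸ k ≈ x ▸ y → f ▸ g ▸ k ▸ r ≈ x ▸ y ▸ r
  prefix₃₂ p = prefix₃₁ p ∙ assocʳ
  prefix₄₁ : ∀ {A B D E F G} {f : Hom A B} {g : Hom B D} {k : Hom D E} {l : Hom E F} {x : Hom A F}
               {r : Hom F G} →
             f ▸ g ▸ k ▸ l ≈ x → f ▸ g ▸ k ▸ l ▸ r ≈ x ▸ r
  prefix₄₁ p = ▹ ▹ assocˡ ∙ prefix₃₁ p
  prefix₅₁ : ∀ {A B D E F G H} {f : Hom A B} {g : Hom B D} {k : Hom D E} {l : Hom E F} {m : Hom F G}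
               {x : Hom A G} {r : Hom G H} →
             f ▸ g ▸ k ▸ l ▸ m ≈ x → f ▸ g ▸ k ▸ l ▸ m ▸ r ≈ x ▸ r
  prefix₅₁ p = ▹ ▹ ▹ assocˡ ∙ prefix₄₁ p

  prefix₁₃ : ∀ {A B D E G} {f : Hom A B} {g : Hom B D} {k : Hom D E} {x : Hom A E} {r : Hom E G} →
             x ≈ f ▸ g ▸ k → x ▸ r ≈ f ▸ g ▸ k ▸ r
  prefix₁₃ p = sym (prefix₃₁ (sym p))
  prefix₂₃ : ∀ {A B D E F G} {f : Hom A B} {g : Hom B D} {k : Hom D E} {x : Hom A F} {y : Hom F E}
               {r : Hom E G} →
             x ▸ y ≈ f ▸ g ▸ k → x ▸ y ▸ r ≈ f ▸ g ▸ k ▸ r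
  prefix₂₃ p = sym (prefix₃₂ (sym p))
  prefix₁₄ : ∀ {A B D E F G} {f : Hom A B} {g : Hom B D} {k : Hom D E} {l : Hom E F} {x : Hom A F}
               {r : Hom F G} →
             x ≈ f ▸ g ▸ k ▸ l → x ▸ r ≈ f ▸ g ▸ k ▸ l ▸ r
  prefix₁₄ p = sym (prefix₄₁ (sym p))
  prefix₁₅ : ∀ {A B D E F G H} {f : Hom A B} {g : Hom B D} {k : Hom D E} {l : Hom E F} {m : Hom F G}
               {x : Hom A G} {r : Hom G H} →
             x ≈ f ▸ g ▸ k ▸ l ▸ m → x ▸ r ≈ f ▸ g ▸ k ▸ l ▸ m ▸ r
  prefix₁₅ p = sym (prefix₅₁ (sym p))

module SymmetricMonoidal {o h e} {C : CatData o h e} (isCategory : IsCategory C)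
                         {M : SymMonData C} (isSymMon : IsSymMon M) where
  open CatData C
  open IsCategory isCategory
  open CategoryReasoning isCategory
  open SymMonData M
  open IsSymMon isSymMon public

  infixr 10 _⟩⊗⟨_
  _⟩⊗⟨_ : ∀ {A B A' B'} {f g : Hom A B} {f' g' : Hom A' B'} → f ≈ g → f' ≈ g' → (f ⊗₁ f') ≈ (g ⊗₁ g')
  _⟩⊗⟨_ = ⊗-resp

  id⊗-⨾ : ∀ {X A B D} {f : Hom A B} {g : Hom B D} → id {X} ⊗₁ (f ⨾ g) ≈ (id ⊗₁ f) ⨾ (id ⊗₁ g)
  id⊗-⨾ = sym (idˡ _) ⟩⊗⟨ refl ∙ ⊗-comp _ _ _ _
  ⊗id-⨾ : ∀ {X A B D} {f : Hom A B} {g : Hom B D} → (f ⨾ g) ⊗₁ id {X} ≈ (f ⊗₁ id) ⨾ (g ⊗₁ id)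
  ⊗id-⨾ = refl ⟩⊗⟨ sym (idˡ _) ∙ ⊗-comp _ _ _ _
  serialize₁₂ : ∀ {A B A' B'} {f : Hom A B} {g : Hom A' B'} → f ⊗₁ g ≈ (f ⊗₁ id) ⨾ (id ⊗₁ g)
  serialize₁₂ = sym (idʳ _) ⟩⊗⟨ sym (idˡ _) ∙ ⊗-comp _ _ _ _
  serialize₂₁ : ∀ {A B A' B'} {f : Hom A B} {g : Hom A' B'} → f ⊗₁ g ≈ (id ⊗₁ g) ⨾ (f ⊗₁ id)
  serialize₂₁ = sym (idˡ _) ⟩⊗⟨ sym (idʳ _) ∙ ⊗-comp _ _ _ _
  ⊗-⨾ : ∀ {A B D A' B' D'} {f : Hom A B} {g : Hom B D} {f' : Hom A' B'} {g' : Hom B' D'} →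
       (f ⨾ g) ⊗₁ (f' ⨾ g') ≈ (f ⊗₁ f') ⨾ (g ⊗₁ g')
  ⊗-⨾ = ⊗-comp _ _ _ _
  ⊗-iso : ∀ {A B A' B'} {f : Hom A B} {g : Hom B A} {f' : Hom A' B'} {g' : Hom B' A'} →
          f ⨾ g ≈ id → f' ⨾ g' ≈ id → (f ⊗₁ f') ⨾ (g ⊗₁ g') ≈ id
  ⊗-iso p q = sym ⊗-⨾ ∙ p ⟩⊗⟨ q ∙ ⊗-id
  id⊗-iso : ∀ {X A B} {f : Hom A B} {g : Hom B A} → f ⨾ g ≈ id → (id {X} ⊗₁ f) ⨾ (id ⊗₁ g) ≈ id
  id⊗-iso p = ⊗-iso (idˡ _) p
  ⊗id-iso : ∀ {X A B} {f : Hom A B} {g : Hom B A} → f ⨾ g ≈ id → (f ⊗₁ id {X}) ⨾ (g ⊗₁ id) ≈ id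
  ⊗id-iso p = ⊗-iso p (idˡ _)

  α⁻¹-nat : ∀ {A B D A' B' D'} (f : Hom A A') (g : Hom B B') (k : Hom D D') →
            (f ⊗₁ (g ⊗₁ k)) ⨾ α⁻¹ A' B' D' ≈ α⁻¹ A B D ⨾ ((f ⊗₁ g) ⊗₁ k)
  α⁻¹-nat f g k = invert-square (α-iso₂ _ _ _) (α-iso₁ _ _ _) (α-nat f g k)

  I⊗-faithful : ∀ {A B} {f g : Hom A B} → id {I} ⊗₁ f ≈ id ⊗₁ g → f ≈ g
  I⊗-faithful {f = f} {g} p =
    switchˡ (lu-iso₂ _) (sym (lu-nat f)) ∙ ▹ (p ⟩⨾⟨refl ∙ lu-nat g) ∙ cancelˡ (lu-iso₂ _)
  ⊗I-faithful : ∀ {A B} {f g : Hom A B} → f ⊗₁ id {I} ≈ g ⊗₁ id → f ≈ g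
  ⊗I-faithful {f = f} {g} p =
    switchˡ (ru-iso₂ _) (sym (ru-nat f)) ∙ ▹ (p ⟩⨾⟨refl ∙ ru-nat g) ∙ cancelˡ (ru-iso₂ _)

  triangle⁻¹ : ∀ A B → (ru⁻¹ A ⊗₁ id {B}) ⨾ α A I B ≈ id ⊗₁ lu⁻¹ B
  triangle⁻¹ A B = switchʳ (id⊗-iso (lu-iso₁ B)) (assocʳ ∙ ▹ triangle A B ∙ ⊗id-iso (ru-iso₂ A)) ∙ idˡ _

  kelly-lu : ∀ A B → α I A B ⨾ lu (A ⊗₀ B) ≈ lu A ⊗₁ id {B}
  kelly-lu A B = I⊗-faithful (switchˡ Qinv (lhs ∙ sym rhs) ∙ cancelˡ Qinv)
    where
      Q : Hom (((I ⊗₀ I) ⊗₀ A) ⊗₀ B) (I ⊗₀ ((I ⊗₀ A) ⊗₀ B))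
      Q = (α I I A ⊗₁ id {B}) ⨾ α I (I ⊗₀ A) B
      Q' : Hom (I ⊗₀ ((I ⊗₀ A) ⊗₀ B)) (((I ⊗₀ I) ⊗₀ A) ⊗₀ B)
      Q' = α⁻¹ I (I ⊗₀ A) B ⨾ (α⁻¹ I I A ⊗₁ id {B})
      Qinv : Q' ⨾ Q ≈ id
      Qinv = assocʳ ∙ ▹ (assocˡ ∙ ⊗id-iso (α-iso₂ _ _ _) ⟩⨾⟨refl ∙ idˡ _) ∙ α-iso₂ _ _ _
      lhs : Q ⨾ (id ⊗₁ (α I A B ⨾ lu (A ⊗₀ B))) ≈ ((ru I ⊗₁ id) ⊗₁ id) ⨾ α I A B
      lhs = ▹ id⊗-⨾ ∙ assocˡ ∙ pentagon I I A B ⟩⨾⟨refl ∙ assocʳ ∙ ▹ triangle I (A ⊗₀ B)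
            ∙ ▹ (refl ⟩⊗⟨ sym ⊗-id) ∙ sym (α-nat _ _ _)
      rhs : Q ⨾ (id ⊗₁ (lu A ⊗₁ id {B})) ≈ ((ru I ⊗₁ id) ⊗₁ id) ⨾ α I A B
      rhs = assocʳ ∙ ▹ sym (α-nat _ _ _) ∙ assocˡ ∙ sym ⊗id-⨾ ⟩⨾⟨refl ∙ (triangle I A ⟩⊗⟨ refl) ⟩⨾⟨refl

  σ-lu : ∀ A → σ A I ⨾ lu A ≈ ru A
  σ-lu A = sym (⊗I-faithful (switchʳ (σ-invol A I) (sym lhs ∙ rhs) ∙ cancelʳ (σ-invol A I)))
    where
      lhs : α A I I ⨾ σ A (I ⊗₀ I) ⨾ α I I A ⨾ lu (I ⊗₀ A) ≈ (ru A ⊗₁ id) ⨾ σ A I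
      lhs = assocʳ ∙ ▹ kelly-lu I A ∙ assocʳ ∙ ▹ sym (σ-nat _ _) ∙ assocˡ ∙ triangle A I ⟩⨾⟨refl
      rhs : α A I I ⨾ σ A (I ⊗₀ I) ⨾ α I I A ⨾ lu (I ⊗₀ A) ≈ ((σ A I ⨾ lu A) ⊗₁ id) ⨾ σ A I
      rhs = hexagon A I I ⟩⨾⟨refl ∙ assocʳ ∙ ▹ lu-nat _ ∙ assocˡ
            ∙ (assocʳ ∙ ▹ kelly-lu A I ∙ sym ⊗id-⨾) ⟩⨾⟨refl

  pentagon▸ : ∀ X Y Z W →
    (α X Y Z ⊗₁ id) ▸ α X (Y ⊗₀ Z) W ▸ (id ⊗₁ α Y Z W) ≈ α (X ⊗₀ Y) Z W ▸ α X Y (Z ⊗₀ W)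
  pentagon▸ X Y Z W = assocˡ ∙ pentagon X Y Z W

  pentagon-α▸id⊗α▸α⁻¹ : ∀ X Y Z W →
    α X (Y ⊗₀ Z) W ▸ (id ⊗₁ α Y Z W) ▸ α⁻¹ X Y (Z ⊗₀ W) ≈ (α⁻¹ X Y Z ⊗₁ id) ▸ α (X ⊗₀ Y) Z W
  pentagon-α▸id⊗α▸α⁻¹ X Y Z W =
    sym (cancelˡ (⊗id-iso (α-iso₂ _ _ _))) ∙ ▹ (prefix₃₁ (pentagon▸ X Y Z W) ∙ cancelʳ (α-iso₁ _ _ _))

  pentagon-id⊗α▸α⁻¹ : ∀ X Y Z W →
    (id ⊗₁ α Y Z W) ▸ α⁻¹ X Y (Z ⊗₀ W) ≈ α⁻¹ X (Y ⊗₀ Z) W ▸ (α⁻¹ X Y Z ⊗₁ id) ▸ α (X ⊗₀ Y) Z W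
  pentagon-id⊗α▸α⁻¹ X Y Z W = switchˡ (α-iso₂ _ _ _) (pentagon-α▸id⊗α▸α⁻¹ X Y Z W)

  pentagon-α⁻¹⊗id▸α▸α : ∀ X Y Z W →
    (α⁻¹ X Y Z ⊗₁ id) ▸ α (X ⊗₀ Y) Z W ▸ α X Y (Z ⊗₀ W) ≈ α X (Y ⊗₀ Z) W ▸ (id ⊗₁ α Y Z W)
  pentagon-α⁻¹⊗id▸α▸α X Y Z W = ▹ sym (pentagon▸ X Y Z W) ∙ cancelˡ (⊗id-iso (α-iso₂ _ _ _))

  pentagon-α▸α▸id⊗α⁻¹ : ∀ X Y Z W →
    α (X ⊗₀ Y) Z W ▸ α X Y (Z ⊗₀ W) ▸ (id ⊗₁ α⁻¹ Y Z W) ≈ (α X Y Z ⊗₁ id) ▸ α X (Y ⊗₀ Z) W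
  pentagon-α▸α▸id⊗α⁻¹ X Y Z W =
    assocˡ ∙ sym (pentagon▸ X Y Z W) ⟩⨾⟨refl ∙ assocʳ ∙ ▹ (assocʳ ∙ ▹ id⊗-iso (α-iso₁ _ _ _) ∙ idʳ _)

  pentagon-α▸id⊗α⁻¹ : ∀ X Y Z W →
    α X Y (Z ⊗₀ W) ▸ (id ⊗₁ α⁻¹ Y Z W) ≈ α⁻¹ (X ⊗₀ Y) Z W ▸ (α X Y Z ⊗₁ id) ▸ α X (Y ⊗₀ Z) W
  pentagon-α▸id⊗α⁻¹ X Y Z W = switchˡ (α-iso₂ _ _ _) (pentagon-α▸α▸id⊗α⁻¹ X Y Z W)

  pentagon-α⁻¹▸α⊗id : ∀ X Y Z W →
    α⁻¹ (X ⊗₀ Y) Z W ▸ (α X Y Z ⊗₁ id) ≈ α X Y (Z ⊗₀ W) ▸ (id ⊗₁ α⁻¹ Y Z W) ▸ α⁻¹ X (Y ⊗₀ Z) W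
  pentagon-α⁻¹▸α⊗id X Y Z W =
    sym (assocˡ ∙ pentagon-α▸id⊗α⁻¹ X Y Z W ⟩⨾⟨refl ∙ assocʳ ∙ ▹ cancelʳ (α-iso₁ _ _ _))

  pentagon-id⊗α⁻¹▸α⁻¹▸α⁻¹⊗id : ∀ X Y Z W →
    (id ⊗₁ α⁻¹ Y Z W) ▸ α⁻¹ X (Y ⊗₀ Z) W ▸ (α⁻¹ X Y Z ⊗₁ id) ≈ α⁻¹ X Y (Z ⊗₀ W) ▸ α⁻¹ (X ⊗₀ Y) Z W
  pentagon-id⊗α⁻¹▸α⁻¹▸α⁻¹⊗id X Y Z W = inverse-unique
    (assocʳ ∙ ▹ assocʳ ∙ ▹ ▹ cancelˡ (⊗id-iso (α-iso₂ _ _ _)) ∙ ▹ cancelˡ (α-iso₂ _ _ _)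
      ∙ id⊗-iso (α-iso₂ _ _ _))
    (assocʳ ∙ ▹ cancelˡ (α-iso₁ _ _ _) ∙ α-iso₁ _ _ _)
    (pentagon▸ X Y Z W)

  θ : ∀ A B D → Hom (A ⊗₀ (B ⊗₀ D)) (B ⊗₀ (A ⊗₀ D))
  θ A B D = α⁻¹ A B D ⨾ (σ A B ⊗₁ id) ⨾ α B A D

  θ-nat : ∀ {A B D A' B' D'} (f : Hom A A') (g : Hom B B') (k : Hom D D') →
          (f ⊗₁ (g ⊗₁ k)) ⨾ θ A' B' D' ≈ θ A B D ⨾ (g ⊗₁ (f ⊗₁ k))
  θ-nat f g k = begin
      (f ⊗₁ (g ⊗₁ k)) ⨾ ((α⁻¹ _ _ _ ⨾ (σ _ _ ⊗₁ id)) ⨾ α _ _ _)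
    ≈⟨ assocˡ ∙ assocˡ ⟩⨾⟨refl ⟩
      (((f ⊗₁ (g ⊗₁ k)) ⨾ α⁻¹ _ _ _) ⨾ (σ _ _ ⊗₁ id)) ⨾ α _ _ _
    ≈⟨ α⁻¹-nat f g k ⟩⨾⟨refl ⟩⨾⟨refl ⟩
      ((α⁻¹ _ _ _ ⨾ ((f ⊗₁ g) ⊗₁ k)) ⨾ (σ _ _ ⊗₁ id)) ⨾ α _ _ _
    ≈⟨ assocʳ ⟩⨾⟨refl ∙ (▹ (sym ⊗-⨾ ∙ σ-nat f g ⟩⊗⟨ (idʳ _ ∙ sym (idˡ _)) ∙ ⊗-⨾)) ⟩⨾⟨refl ⟩
      (α⁻¹ _ _ _ ⨾ ((σ _ _ ⊗₁ id) ⨾ ((g ⊗₁ f) ⊗₁ k))) ⨾ α _ _ _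
    ≈⟨ assocˡ ⟩⨾⟨refl ∙ assocʳ ∙ ▹ α-nat g f k ∙ assocˡ ⟩
      ((α⁻¹ _ _ _ ⨾ (σ _ _ ⊗₁ id)) ⨾ α _ _ _) ⨾ (g ⊗₁ (f ⊗₁ k))
    ∎
    where open HomReasoning

  ex-nat : ∀ {A B D E A' B' D' E'} (f : Hom A A') (g : Hom B B') (k : Hom D D') (l : Hom E E') →
           ((f ⊗₁ g) ⊗₁ (k ⊗₁ l)) ⨾ ex A' B' D' E' ≈ ex A B D E ⨾ ((f ⊗₁ k) ⊗₁ (g ⊗₁ l))
  ex-nat f g k l = begin
      ((f ⊗₁ g) ⊗₁ (k ⊗₁ l)) ⨾ ((α _ _ _ ⨾ (id ⊗₁ θ _ _ _)) ⨾ α⁻¹ _ _ _)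
    ≈⟨ assocˡ ∙ assocˡ ⟩⨾⟨refl ⟩
      ((((f ⊗₁ g) ⊗₁ (k ⊗₁ l)) ⨾ α _ _ _) ⨾ (id ⊗₁ θ _ _ _)) ⨾ α⁻¹ _ _ _
    ≈⟨ α-nat _ _ _ ⟩⨾⟨refl ⟩⨾⟨refl ⟩
      ((α _ _ _ ⨾ (f ⊗₁ (g ⊗₁ (k ⊗₁ l)))) ⨾ (id ⊗₁ θ _ _ _)) ⨾ α⁻¹ _ _ _
    ≈⟨ assocʳ ⟩⨾⟨refl ∙ (▹ (sym ⊗-⨾ ∙ (idʳ _ ∙ sym (idˡ _)) ⟩⊗⟨ θ-nat g k l ∙ ⊗-⨾)) ⟩⨾⟨refl ⟩
      (α _ _ _ ⨾ ((id ⊗₁ θ _ _ _) ⨾ (f ⊗₁ (k ⊗₁ (g ⊗₁ l))))) ⨾ α⁻¹ _ _ _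
    ≈⟨ assocˡ ⟩⨾⟨refl ∙ assocʳ ∙ ▹ α⁻¹-nat _ _ _ ∙ assocˡ ⟩
      ((α _ _ _ ⨾ (id ⊗₁ θ _ _ _)) ⨾ α⁻¹ _ _ _) ⨾ ((f ⊗₁ k) ⊗₁ (g ⊗₁ l))
    ∎
    where open HomReasoning

  ru⁻¹-nat : ∀ {A B} (f : Hom A B) → f ⨾ ru⁻¹ B ≈ ru⁻¹ A ⨾ (f ⊗₁ id)
  ru⁻¹-nat f = invert-square (ru-iso₂ _) (ru-iso₁ _) (ru-nat f)
  lu⁻¹-nat : ∀ {A B} (f : Hom A B) → f ⨾ lu⁻¹ B ≈ lu⁻¹ A ⨾ (id ⊗₁ f)
  lu⁻¹-nat f = invert-square (lu-iso₂ _) (lu-iso₁ _) (lu-nat f)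

  ru⁻¹σ : ∀ A → ru⁻¹ A ⨾ σ A I ≈ lu⁻¹ A
  ru⁻¹σ A = switchʳ (lu-iso₁ A) (assocʳ ∙ ▹ σ-lu A ∙ ru-iso₂ A) ∙ idˡ _
  lu⁻¹σ : ∀ A → lu⁻¹ A ⨾ σ I A ≈ ru⁻¹ A
  lu⁻¹σ A = sym (ru⁻¹σ A) ⟩⨾⟨refl ∙ assocʳ ∙ ▹ σ-invol A I ∙ idʳ _

  kelly-lu⁻¹ : ∀ A B → (lu⁻¹ A ⊗₁ id {B}) ⨾ α I A B ≈ lu⁻¹ (A ⊗₀ B)
  kelly-lu⁻¹ A B = switchʳ (lu-iso₁ _) (assocʳ ∙ ▹ kelly-lu A B ∙ ⊗id-iso (lu-iso₂ A)) ∙ idˡ _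

  θ-unfold : ∀ {X Y Z} → θ X Y Z ≈ α⁻¹ X Y Z ▸ (σ X Y ⊗₁ id) ▸ α Y X Z
  θ-unfold = assocʳ

  σ-⊗ʳ : ∀ X Y Z → σ X (Y ⊗₀ Z) ≈ α⁻¹ X Y Z ▸ (σ X Y ⊗₁ id) ▸ α Y X Z ▸ (id ⊗₁ σ X Z) ▸ α⁻¹ Y Z X
  σ-⊗ʳ X Y Z = sym (cancelˡ (α-iso₂ _ _ _)) ∙ ▹ (switchʳ (α-iso₁ _ _ _) (hexagon X Y Z) ∙ assocʳ ∙ assocʳ)

  θ-⊗₂ : ∀ X Y Y' Z →
    θ X (Y ⊗₀ Y') Z ≈ (id ⊗₁ α Y Y' Z) ▸ θ X Y (Y' ⊗₀ Z) ▸ (id ⊗₁ θ X Y' Z) ▸ α⁻¹ Y Y' (X ⊗₀ Z)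
  θ-⊗₂ X Y Y' Z = begin
      θ X (Y ⊗₀ Y') Z
    ≈⟨ θ-unfold ∙ ▹ (σ-⊗ʳ X Y Y' ⟩⊗⟨ refl ∙ ⊗id-⨾ ∙ ▹ ⊗id-⨾ ∙ ▹ ▹ ⊗id-⨾ ∙ ▹ ▹ ▹ ⊗id-⨾) ⟩⨾⟨refl
       ∙ ▹ assocʳ ∙ ▹ ▹ assocʳ ∙ ▹ ▹ ▹ assocʳ ∙ ▹ ▹ ▹ ▹ assocʳ ⟩
      α⁻¹ X (Y ⊗₀ Y') Z ▸ (α⁻¹ X Y Y' ⊗₁ id) ▸ ((σ X Y ⊗₁ id) ⊗₁ id) ▸ (α Y X Y' ⊗₁ id)
        ▸ ((id ⊗₁ σ X Y') ⊗₁ id) ▸ (α⁻¹ Y Y' X ⊗₁ id) ▸ α (Y ⊗₀ Y') X Z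
    ≈⟨ ▹ ▹ ▹ ▹ ▹ pentagon-α▸id⊗α▸α⁻¹ Y Y' X Z ⟨
      α⁻¹ X (Y ⊗₀ Y') Z ▸ (α⁻¹ X Y Y' ⊗₁ id) ▸ ((σ X Y ⊗₁ id) ⊗₁ id) ▸ (α Y X Y' ⊗₁ id)
        ▸ ((id ⊗₁ σ X Y') ⊗₁ id) ▸ α Y (Y' ⊗₀ X) Z ▸ (id ⊗₁ α Y' X Z) ▸ α⁻¹ Y Y' (X ⊗₀ Z)
    ≈⟨ ▹ ▹ ▹ ▹ prefix₂₂ (sym (α-nat _ _ _)) ⟨
      α⁻¹ X (Y ⊗₀ Y') Z ▸ (α⁻¹ X Y Y' ⊗₁ id) ▸ ((σ X Y ⊗₁ id) ⊗₁ id) ▸ (α Y X Y' ⊗₁ id)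
        ▸ α Y (X ⊗₀ Y') Z ▸ (id ⊗₁ (σ X Y' ⊗₁ id)) ▸ (id ⊗₁ α Y' X Z) ▸ α⁻¹ Y Y' (X ⊗₀ Z)
    ≈⟨ ▹ ▹ ▹ ▹ ▹ prefix₂₂ (sym id⊗-⨾ ∙ refl ⟩⊗⟨ (assocˡ ∙ cancelˡ (α-iso₁ _ _ _) ⟩⨾⟨refl) ∙ id⊗-⨾) ⟨
      α⁻¹ X (Y ⊗₀ Y') Z ▸ (α⁻¹ X Y Y' ⊗₁ id) ▸ ((σ X Y ⊗₁ id) ⊗₁ id) ▸ (α Y X Y' ⊗₁ id)
        ▸ α Y (X ⊗₀ Y') Z ▸ (id ⊗₁ α X Y' Z) ▸ (id ⊗₁ θ X Y' Z) ▸ α⁻¹ Y Y' (X ⊗₀ Z)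
    ≈⟨ ▹ ▹ ▹ prefix₃₂ (pentagon▸ Y X Y' Z) ⟩
      α⁻¹ X (Y ⊗₀ Y') Z ▸ (α⁻¹ X Y Y' ⊗₁ id) ▸ ((σ X Y ⊗₁ id) ⊗₁ id) ▸ α (Y ⊗₀ X) Y' Z
        ▸ α Y X (Y' ⊗₀ Z) ▸ (id ⊗₁ θ X Y' Z) ▸ α⁻¹ Y Y' (X ⊗₀ Z)
    ≈⟨ ▹ ▹ prefix₂₂ (α-nat _ _ _ ∙ ▹ (refl ⟩⊗⟨ ⊗-id)) ⟩
      α⁻¹ X (Y ⊗₀ Y') Z ▸ (α⁻¹ X Y Y' ⊗₁ id) ▸ α (X ⊗₀ Y) Y' Z ▸ (σ X Y ⊗₁ id)
        ▸ α Y X (Y' ⊗₀ Z) ▸ (id ⊗₁ θ X Y' Z) ▸ α⁻¹ Y Y' (X ⊗₀ Z)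
    ≈⟨ prefix₂₃ (pentagon-id⊗α▸α⁻¹ X Y Y' Z) ⟨
      (id ⊗₁ α Y Y' Z) ▸ α⁻¹ X Y (Y' ⊗₀ Z) ▸ (σ X Y ⊗₁ id)
        ▸ α Y X (Y' ⊗₀ Z) ▸ (id ⊗₁ θ X Y' Z) ▸ α⁻¹ Y Y' (X ⊗₀ Z)
    ≈⟨ ▹ prefix₁₃ θ-unfold ⟨
      (id ⊗₁ α Y Y' Z) ▸ θ X Y (Y' ⊗₀ Z) ▸ (id ⊗₁ θ X Y' Z) ▸ α⁻¹ Y Y' (X ⊗₀ Z)
    ∎
    where open HomReasoning

  σ-⊗ʳ-θ : ∀ X Y Z → σ X (Y ⊗₀ Z) ≈ θ X Y Z ▸ (id ⊗₁ σ X Z) ▸ α⁻¹ Y Z X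
  σ-⊗ʳ-θ X Y Z = σ-⊗ʳ X Y Z ∙ prefix₃₁ (sym θ-unfold)

  σ-⊗ˡ : ∀ X Y Z → σ (X ⊗₀ Y) Z ≈ α X Y Z ▸ (id ⊗₁ σ Y Z) ▸ α⁻¹ X Z Y ▸ (σ X Z ⊗₁ id) ▸ α Z X Y
  σ-⊗ˡ X Y Z = inverse-unique (σ-invol _ _) cancels (σ-⊗ʳ Z X Y)
    where
      cancels : (α⁻¹ Z X Y ▸ (σ Z X ⊗₁ id) ▸ α X Z Y ▸ (id ⊗₁ σ Z Y) ▸ α⁻¹ X Y Z)
                ⨾ (α X Y Z ▸ (id ⊗₁ σ Y Z) ▸ α⁻¹ X Z Y ▸ (σ X Z ⊗₁ id) ▸ α Z X Y) ≈ id
      cancels = assocʳ ∙ ▹ assocʳ ∙ ▹ ▹ assocʳ ∙ ▹ ▹ ▹ assocʳ ∙ ▹ ▹ ▹ ▹ cancelˡ (α-iso₂ _ _ _)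
           ∙ ▹ ▹ ▹ cancelˡ (id⊗-iso (σ-invol Z Y)) ∙ ▹ ▹ cancelˡ (α-iso₁ _ _ _)
           ∙ ▹ cancelˡ (⊗id-iso (σ-invol Z X)) ∙ α-iso₂ _ _ _
  σ-⊗ˡ-θ : ∀ X Y Z → σ (X ⊗₀ Y) Z ≈ α X Y Z ▸ (id ⊗₁ σ Y Z) ▸ θ X Z Y
  σ-⊗ˡ-θ X Y Z = σ-⊗ˡ X Y Z ∙ ▹ ▹ sym θ-unfold

  θ-⊗₁ : ∀ X X' Y Z →
    θ (X ⊗₀ X') Y Z ≈ α X X' (Y ⊗₀ Z) ▸ (id ⊗₁ θ X' Y Z) ▸ θ X Y (X' ⊗₀ Z) ▸ (id ⊗₁ α⁻¹ X X' Z)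
  θ-⊗₁ X X' Y Z = begin
      θ (X ⊗₀ X') Y Z
    ≈⟨ θ-unfold ∙ ▹ (σ-⊗ˡ X X' Y ⟩⊗⟨ refl ∙ ⊗id-⨾ ∙ ▹ ⊗id-⨾ ∙ ▹ ▹ ⊗id-⨾ ∙ ▹ ▹ ▹ ⊗id-⨾) ⟩⨾⟨refl
       ∙ ▹ assocʳ ∙ ▹ ▹ assocʳ ∙ ▹ ▹ ▹ assocʳ ∙ ▹ ▹ ▹ ▹ assocʳ ⟩
      α⁻¹ (X ⊗₀ X') Y Z ▸ (α X X' Y ⊗₁ id) ▸ ((id ⊗₁ σ X' Y) ⊗₁ id) ▸ (α⁻¹ X Y X' ⊗₁ id)
        ▸ ((σ X Y ⊗₁ id) ⊗₁ id) ▸ (α Y X X' ⊗₁ id) ▸ α Y (X ⊗₀ X') Z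
    ≈⟨ ▹ ▹ ▹ ▹ ▹ pentagon-α▸α▸id⊗α⁻¹ Y X X' Z ⟨
      α⁻¹ (X ⊗₀ X') Y Z ▸ (α X X' Y ⊗₁ id) ▸ ((id ⊗₁ σ X' Y) ⊗₁ id) ▸ (α⁻¹ X Y X' ⊗₁ id)
        ▸ ((σ X Y ⊗₁ id) ⊗₁ id) ▸ α (Y ⊗₀ X) X' Z ▸ α Y X (X' ⊗₀ Z) ▸ (id ⊗₁ α⁻¹ X X' Z)
    ≈⟨ ▹ ▹ ▹ ▹ prefix₂₂ (α-nat _ _ _ ∙ ▹ (refl ⟩⊗⟨ ⊗-id)) ⟩
      α⁻¹ (X ⊗₀ X') Y Z ▸ (α X X' Y ⊗₁ id) ▸ ((id ⊗₁ σ X' Y) ⊗₁ id) ▸ (α⁻¹ X Y X' ⊗₁ id)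
        ▸ α (X ⊗₀ Y) X' Z ▸ (σ X Y ⊗₁ id) ▸ α Y X (X' ⊗₀ Z) ▸ (id ⊗₁ α⁻¹ X X' Z)
    ≈⟨ ▹ ▹ ▹ prefix₃₂ (pentagon-α▸id⊗α▸α⁻¹ X Y X' Z) ⟨
      α⁻¹ (X ⊗₀ X') Y Z ▸ (α X X' Y ⊗₁ id) ▸ ((id ⊗₁ σ X' Y) ⊗₁ id) ▸ α X (Y ⊗₀ X') Z
        ▸ (id ⊗₁ α Y X' Z) ▸ α⁻¹ X Y (X' ⊗₀ Z) ▸ (σ X Y ⊗₁ id) ▸ α Y X (X' ⊗₀ Z) ▸ (id ⊗₁ α⁻¹ X X' Z)
    ≈⟨ ▹ ▹ prefix₂₂ (α-nat _ _ _) ⟩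
      α⁻¹ (X ⊗₀ X') Y Z ▸ (α X X' Y ⊗₁ id) ▸ α X (X' ⊗₀ Y) Z ▸ (id ⊗₁ (σ X' Y ⊗₁ id))
        ▸ (id ⊗₁ α Y X' Z) ▸ α⁻¹ X Y (X' ⊗₀ Z) ▸ (σ X Y ⊗₁ id) ▸ α Y X (X' ⊗₀ Z) ▸ (id ⊗₁ α⁻¹ X X' Z)
    ≈⟨ prefix₂₃ (pentagon-α▸id⊗α⁻¹ X X' Y Z) ⟨
      α X X' (Y ⊗₀ Z) ▸ (id ⊗₁ α⁻¹ X' Y Z) ▸ (id ⊗₁ (σ X' Y ⊗₁ id))
        ▸ (id ⊗₁ α Y X' Z) ▸ α⁻¹ X Y (X' ⊗₀ Z) ▸ (σ X Y ⊗₁ id) ▸ α Y X (X' ⊗₀ Z) ▸ (id ⊗₁ α⁻¹ X X' Z)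
    ≈⟨ ▹ prefix₃₁ (sym (id⊗-⨾ ∙ ▹ id⊗-⨾) ∙ refl ⟩⊗⟨ sym θ-unfold) ∙ ▹ ▹ prefix₃₁ (sym θ-unfold) ⟩
      α X X' (Y ⊗₀ Z) ▸ (id ⊗₁ θ X' Y Z) ▸ θ X Y (X' ⊗₀ Z) ▸ (id ⊗₁ α⁻¹ X X' Z)
    ∎
    where open HomReasoning

  θ-⊗₃ : ∀ X Y Z W →
    θ X Y (Z ⊗₀ W)
    ≈ (id ⊗₁ α⁻¹ Y Z W) ▸ α⁻¹ X (Y ⊗₀ Z) W ▸ (θ X Y Z ⊗₁ id) ▸ α Y (X ⊗₀ Z) W ▸ (id ⊗₁ α X Z W)
  θ-⊗₃ X Y Z W = sym (begin
      (id ⊗₁ α⁻¹ Y Z W) ▸ α⁻¹ X (Y ⊗₀ Z) W ▸ (θ X Y Z ⊗₁ id) ▸ α Y (X ⊗₀ Z) W ▸ (id ⊗₁ α X Z W)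
    ≈⟨ ▹ ▹ prefix₁₃ (θ-unfold ⟩⊗⟨ refl ∙ ⊗id-⨾ ∙ ▹ ⊗id-⨾) ⟩
      (id ⊗₁ α⁻¹ Y Z W) ▸ α⁻¹ X (Y ⊗₀ Z) W ▸ (α⁻¹ X Y Z ⊗₁ id) ▸ ((σ X Y ⊗₁ id) ⊗₁ id) ▸ (α Y X Z ⊗₁ id)
        ▸ α Y (X ⊗₀ Z) W ▸ (id ⊗₁ α X Z W)
    ≈⟨ prefix₃₂ (pentagon-id⊗α⁻¹▸α⁻¹▸α⁻¹⊗id X Y Z W) ⟩
      α⁻¹ X Y (Z ⊗₀ W) ▸ α⁻¹ (X ⊗₀ Y) Z W ▸ ((σ X Y ⊗₁ id) ⊗₁ id) ▸ (α Y X Z ⊗₁ id)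
        ▸ α Y (X ⊗₀ Z) W ▸ (id ⊗₁ α X Z W)
    ≈⟨ ▹ prefix₂₂ (sym (α⁻¹-nat _ _ _) ∙ (refl ⟩⊗⟨ ⊗-id) ⟩⨾⟨refl) ⟩
      α⁻¹ X Y (Z ⊗₀ W) ▸ (σ X Y ⊗₁ id) ▸ α⁻¹ (Y ⊗₀ X) Z W ▸ (α Y X Z ⊗₁ id)
        ▸ α Y (X ⊗₀ Z) W ▸ (id ⊗₁ α X Z W)
    ≈⟨ ▹ ▹ (▹ pentagon▸ Y X Z W ∙ cancelˡ (α-iso₂ _ _ _)) ⟩
      α⁻¹ X Y (Z ⊗₀ W) ▸ (σ X Y ⊗₁ id) ▸ α Y X (Z ⊗₀ W)
    ≈⟨ θ-unfold ⟨
      θ X Y (Z ⊗₀ W)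
    ∎)
    where open HomReasoning

  θ-involutive : ∀ X Y Z → θ X Y Z ⨾ θ Y X Z ≈ id
  θ-involutive X Y Z = θ-unfold ⟩⨾⟨ θ-unfold ∙ assocʳ ∙ ▹ assocʳ ∙ ▹ ▹ cancelˡ (α-iso₁ _ _ _)
    ∙ ▹ cancelˡ (⊗id-iso (σ-invol X Y)) ∙ α-iso₂ _ _ _

  ex-unfold : ∀ {A B D E} → ex A B D E ≈ α A B (D ⊗₀ E) ▸ (id ⊗₁ θ B D E) ▸ α⁻¹ A D (B ⊗₀ E)
  ex-unfold = assocʳ

  α-natʳ : ∀ {A B D D'} (k : Hom D D') → (id {A ⊗₀ B} ⊗₁ k) ▸ α A B D' ≈ α A B D ▸ (id ⊗₁ (id ⊗₁ k))
  α-natʳ k = (sym ⊗-id ⟩⊗⟨ refl) ⟩⨾⟨refl ∙ α-nat id id k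
  α⁻¹-natʳ : ∀ {A B D D'} (k : Hom D D') → (id ⊗₁ (id ⊗₁ k)) ▸ α⁻¹ A B D' ≈ α⁻¹ A B D ▸ (id {A ⊗₀ B} ⊗₁ k)
  α⁻¹-natʳ k = α⁻¹-nat id id k ∙ ▹ (⊗-id ⟩⊗⟨ refl)

  ex-σ : ∀ p q r s → σ (p ⊗₀ q) (r ⊗₀ s) ▸ ex r s p q ≈ ex p q r s ▸ (σ p r ⊗₁ σ q s)
  ex-σ p q r s = begin
      σ (p ⊗₀ q) (r ⊗₀ s) ▸ ex r s p q
    ≈⟨ prefix₁₃ (σ-⊗ˡ-θ p q (r ⊗₀ s)) ⟩
      α p q (r ⊗₀ s) ▸ (id ⊗₁ σ q (r ⊗₀ s)) ▸ θ p (r ⊗₀ s) q ▸ ex r s p q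
    ≈⟨ ▹ prefix₁₃ (refl ⟩⊗⟨ σ-⊗ʳ-θ q r s ∙ id⊗-⨾ ∙ ▹ id⊗-⨾) ⟩
      α p q (r ⊗₀ s) ▸ (id ⊗₁ θ q r s) ▸ (id ⊗₁ (id ⊗₁ σ q s)) ▸ (id ⊗₁ α⁻¹ r s q)
        ▸ θ p (r ⊗₀ s) q ▸ ex r s p q
    ≈⟨ ▹ ▹ ▹ ▹ prefix₁₄ (θ-⊗₂ p r s q) ⟩
      α p q (r ⊗₀ s) ▸ (id ⊗₁ θ q r s) ▸ (id ⊗₁ (id ⊗₁ σ q s)) ▸ (id ⊗₁ α⁻¹ r s q)
        ▸ (id ⊗₁ α r s q) ▸ θ p r (s ⊗₀ q) ▸ (id ⊗₁ θ p s q) ▸ α⁻¹ r s (p ⊗₀ q) ▸ ex r s p q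
    ≈⟨ ▹ ▹ ▹ cancelˡ (id⊗-iso (α-iso₂ _ _ _)) ⟩
      α p q (r ⊗₀ s) ▸ (id ⊗₁ θ q r s) ▸ (id ⊗₁ (id ⊗₁ σ q s))
        ▸ θ p r (s ⊗₀ q) ▸ (id ⊗₁ θ p s q) ▸ α⁻¹ r s (p ⊗₀ q) ▸ ex r s p q
    ≈⟨ ▹ ▹ ▹ ▹ ▹ (▹ ex-unfold ∙ cancelˡ (α-iso₂ _ _ _)) ⟩
      α p q (r ⊗₀ s) ▸ (id ⊗₁ θ q r s) ▸ (id ⊗₁ (id ⊗₁ σ q s))
        ▸ θ p r (s ⊗₀ q) ▸ (id ⊗₁ θ p s q) ▸ (id ⊗₁ θ s p q) ▸ α⁻¹ r p (s ⊗₀ q)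
    ≈⟨ ▹ ▹ ▹ ▹ cancelˡ (id⊗-iso (θ-involutive p s q)) ⟩
      α p q (r ⊗₀ s) ▸ (id ⊗₁ θ q r s) ▸ (id ⊗₁ (id ⊗₁ σ q s)) ▸ θ p r (s ⊗₀ q) ▸ α⁻¹ r p (s ⊗₀ q)
    ≈⟨ ▹ ▹ prefix₂₂ (θ-nat id id (σ q s)) ⟩
      α p q (r ⊗₀ s) ▸ (id ⊗₁ θ q r s) ▸ θ p r (q ⊗₀ s) ▸ (id ⊗₁ (id ⊗₁ σ q s)) ▸ α⁻¹ r p (s ⊗₀ q)
    ≈⟨ ▹ ▹ prefix₁₃ θ-unfold ⟩
      α p q (r ⊗₀ s) ▸ (id ⊗₁ θ q r s) ▸ α⁻¹ p r (q ⊗₀ s) ▸ (σ p r ⊗₁ id) ▸ α r p (q ⊗₀ s)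
        ▸ (id ⊗₁ (id ⊗₁ σ q s)) ▸ α⁻¹ r p (s ⊗₀ q)
    ≈⟨ ▹ ▹ ▹ ▹ (▹ α⁻¹-natʳ (σ q s) ∙ cancelˡ (α-iso₁ _ _ _)) ⟩
      α p q (r ⊗₀ s) ▸ (id ⊗₁ θ q r s) ▸ α⁻¹ p r (q ⊗₀ s) ▸ (σ p r ⊗₁ id) ▸ (id ⊗₁ σ q s)
    ≈⟨ ▹ ▹ ▹ serialize₁₂ ⟨
      α p q (r ⊗₀ s) ▸ (id ⊗₁ θ q r s) ▸ α⁻¹ p r (q ⊗₀ s) ▸ (σ p r ⊗₁ σ q s)
    ≈⟨ prefix₁₃ ex-unfold ⟨
      ex p q r s ▸ (σ p r ⊗₁ σ q s)
    ∎
    where open HomReasoning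

  ex-unit : ∀ A A' → (ru⁻¹ I ⊗₁ id) ▸ ex I I A A' ▸ (lu A ⊗₁ lu A') ≈ lu (A ⊗₀ A')
  ex-unit A A' = begin
      (ru⁻¹ I ⊗₁ id) ▸ ex I I A A' ▸ (lu A ⊗₁ lu A')
    ≈⟨ ▹ prefix₁₃ ex-unfold ⟩
      (ru⁻¹ I ⊗₁ id) ▸ α I I (A ⊗₀ A') ▸ (id ⊗₁ θ I A A') ▸ α⁻¹ I A (I ⊗₀ A') ▸ (lu A ⊗₁ lu A')
    ≈⟨ prefix₂₁ (triangle⁻¹ I (A ⊗₀ A')) ⟩
      (id ⊗₁ lu⁻¹ (A ⊗₀ A')) ▸ (id ⊗₁ θ I A A') ▸ α⁻¹ I A (I ⊗₀ A') ▸ (lu A ⊗₁ lu A')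
    ≈⟨ prefix₂₁ (sym id⊗-⨾ ∙ refl ⟩⊗⟨ lu⁻¹⨾θ) ⟩
      (id ⊗₁ (id ⊗₁ lu⁻¹ A')) ▸ α⁻¹ I A (I ⊗₀ A') ▸ (lu A ⊗₁ lu A')
    ≈⟨ prefix₂₁ (α⁻¹-nat _ _ _) ∙ assocʳ ∙ ▹ (sym ⊗-⨾ ∙ (⊗-id ⟩⨾⟨refl ∙ idˡ _) ⟩⊗⟨ lu-iso₂ A') ⟩
      α⁻¹ I A A' ▸ (lu A ⊗₁ id)
    ≈⟨ sym (switchˡ (α-iso₂ _ _ _) (kelly-lu A A')) ⟩
      lu (A ⊗₀ A')
    ∎
    where
      open HomReasoning
      lu⁻¹⨾θ : lu⁻¹ (A ⊗₀ A') ⨾ θ I A A' ≈ id ⊗₁ lu⁻¹ A'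
      lu⁻¹⨾θ = ▹ θ-unfold ∙ prefix₂₁ (sym (switchʳ (α-iso₁ _ _ _) (kelly-lu⁻¹ A A')))
          ∙ prefix₂₁ (sym ⊗id-⨾ ∙ lu⁻¹σ A ⟩⊗⟨ refl) ∙ triangle⁻¹ A A'

  private module ExAssociativity (a₁ a₂ b₁ b₂ d₁ d₂ : Obj) where
    Q R B D : Obj
    Q = b₁ ⊗₀ b₂
    R = d₁ ⊗₀ d₂
    B = b₁ ⊗₀ d₁
    D = b₂ ⊗₀ d₂

    tail : Hom (a₁ ⊗₀ (b₁ ⊗₀ (a₂ ⊗₀ (b₂ ⊗₀ R)))) ((a₁ ⊗₀ B) ⊗₀ (a₂ ⊗₀ D))
    tail = (id ⊗₁ (id ⊗₁ (id ⊗₁ θ b₂ d₁ d₂))) ▸ (id ⊗₁ (id ⊗₁ θ a₂ d₁ D))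
        ▸ (id ⊗₁ α⁻¹ b₁ d₁ (a₂ ⊗₀ D)) ▸ α⁻¹ a₁ B (a₂ ⊗₀ D)

    middle : Hom (((a₁ ⊗₀ a₂) ⊗₀ Q) ⊗₀ R) ((a₁ ⊗₀ B) ⊗₀ (a₂ ⊗₀ D))
    middle = (α a₁ a₂ Q ⊗₁ id) ▸ α a₁ (a₂ ⊗₀ Q) R ▸ (id ⊗₁ (θ a₂ b₁ b₂ ⊗₁ id))
             ▸ (id ⊗₁ α b₁ (a₂ ⊗₀ b₂) R) ▸ (id ⊗₁ (id ⊗₁ α a₂ b₂ R)) ▸ tail

    lhs≈middle : α (a₁ ⊗₀ a₂) Q R ▸ (id ⊗₁ ex b₁ b₂ d₁ d₂) ▸ ex a₁ a₂ B D ≈ middle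
    lhs≈middle = begin
        α (a₁ ⊗₀ a₂) Q R ▸ (id ⊗₁ ex b₁ b₂ d₁ d₂) ▸ ex a₁ a₂ B D
      ≈⟨ ▹ (prefix₁₃ (refl ⟩⊗⟨ ex-unfold ∙ id⊗-⨾ ∙ ▹ id⊗-⨾) ∙ ▹ ▹ ▹ ex-unfold) ⟩
        α (a₁ ⊗₀ a₂) Q R ▸ (id ⊗₁ α b₁ b₂ R) ▸ (id ⊗₁ (id ⊗₁ θ b₂ d₁ d₂)) ▸ (id ⊗₁ α⁻¹ b₁ d₁ D)
          ▸ α a₁ a₂ (B ⊗₀ D) ▸ (id ⊗₁ θ a₂ B D) ▸ α⁻¹ a₁ B (a₂ ⊗₀ D)
      ≈⟨ ▹ ▹ ▹ ▹ ▹ prefix₁₄ (refl ⟩⊗⟨ θ-⊗₂ a₂ b₁ d₁ D ∙ id⊗-⨾ ∙ ▹ id⊗-⨾ ∙ ▹ ▹ id⊗-⨾) ⟩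
        α (a₁ ⊗₀ a₂) Q R ▸ (id ⊗₁ α b₁ b₂ R) ▸ (id ⊗₁ (id ⊗₁ θ b₂ d₁ d₂)) ▸ (id ⊗₁ α⁻¹ b₁ d₁ D)
          ▸ α a₁ a₂ (B ⊗₀ D) ▸ (id ⊗₁ (id ⊗₁ α b₁ d₁ D)) ▸ (id ⊗₁ θ a₂ b₁ (d₁ ⊗₀ D))
          ▸ (id ⊗₁ (id ⊗₁ θ a₂ d₁ D)) ▸ (id ⊗₁ α⁻¹ b₁ d₁ (a₂ ⊗₀ D)) ▸ α⁻¹ a₁ B (a₂ ⊗₀ D)
      ≈⟨ ▹ ▹ ▹ (prefix₂₂ (α-natʳ _) ∙ ▹ cancelˡ (id⊗-iso (id⊗-iso (α-iso₂ _ _ _)))) ⟩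
        α (a₁ ⊗₀ a₂) Q R ▸ (id ⊗₁ α b₁ b₂ R) ▸ (id ⊗₁ (id ⊗₁ θ b₂ d₁ d₂))
          ▸ α a₁ a₂ (b₁ ⊗₀ (d₁ ⊗₀ D)) ▸ (id ⊗₁ θ a₂ b₁ (d₁ ⊗₀ D))
          ▸ (id ⊗₁ (id ⊗₁ θ a₂ d₁ D)) ▸ (id ⊗₁ α⁻¹ b₁ d₁ (a₂ ⊗₀ D)) ▸ α⁻¹ a₁ B (a₂ ⊗₀ D)
      ≈⟨ ▹ ▹ prefix₂₂ (α-natʳ _) ⟩
        α (a₁ ⊗₀ a₂) Q R ▸ (id ⊗₁ α b₁ b₂ R) ▸ α a₁ a₂ (b₁ ⊗₀ (b₂ ⊗₀ R)) ▸ (id ⊗₁ (id ⊗₁ (id ⊗₁ θ b₂ d₁ d₂)))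
          ▸ (id ⊗₁ θ a₂ b₁ (d₁ ⊗₀ D))
          ▸ (id ⊗₁ (id ⊗₁ θ a₂ d₁ D)) ▸ (id ⊗₁ α⁻¹ b₁ d₁ (a₂ ⊗₀ D)) ▸ α⁻¹ a₁ B (a₂ ⊗₀ D)
      ≈⟨ ▹ ▹ ▹ prefix₂₂ (sym id⊗-⨾ ∙ refl ⟩⊗⟨ θ-nat id id (θ b₂ d₁ d₂) ∙ id⊗-⨾) ⟩
        α (a₁ ⊗₀ a₂) Q R ▸ (id ⊗₁ α b₁ b₂ R) ▸ α a₁ a₂ (b₁ ⊗₀ (b₂ ⊗₀ R)) ▸ (id ⊗₁ θ a₂ b₁ (b₂ ⊗₀ R)) ▸ tail
      ≈⟨ ▹ ▹ ▹ prefix₁₅ (refl ⟩⊗⟨ θ-⊗₃ a₂ b₁ b₂ R ∙ id⊗-⨾ ∙ ▹ id⊗-⨾ ∙ ▹ ▹ id⊗-⨾ ∙ ▹ ▹ ▹ id⊗-⨾) ⟩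
        α (a₁ ⊗₀ a₂) Q R ▸ (id ⊗₁ α b₁ b₂ R) ▸ α a₁ a₂ (b₁ ⊗₀ (b₂ ⊗₀ R)) ▸ (id ⊗₁ (id ⊗₁ α⁻¹ b₁ b₂ R))
          ▸ (id ⊗₁ α⁻¹ a₂ Q R) ▸ (id ⊗₁ (θ a₂ b₁ b₂ ⊗₁ id)) ▸ (id ⊗₁ α b₁ (a₂ ⊗₀ b₂) R)
          ▸ (id ⊗₁ (id ⊗₁ α a₂ b₂ R)) ▸ tail
      ≈⟨ ▹ (▹ prefix₂₂ (sym (α-natʳ _)) ∙ cancelˡ (id⊗-iso (α-iso₁ _ _ _))) ⟩
        α (a₁ ⊗₀ a₂) Q R ▸ α a₁ a₂ (Q ⊗₀ R)
          ▸ (id ⊗₁ α⁻¹ a₂ Q R) ▸ (id ⊗₁ (θ a₂ b₁ b₂ ⊗₁ id)) ▸ (id ⊗₁ α b₁ (a₂ ⊗₀ b₂) R)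
          ▸ (id ⊗₁ (id ⊗₁ α a₂ b₂ R)) ▸ tail
      ≈⟨ prefix₃₂ (pentagon-α▸α▸id⊗α⁻¹ a₁ a₂ Q R) ⟩
        (α a₁ a₂ Q ⊗₁ id) ▸ α a₁ (a₂ ⊗₀ Q) R ▸ (id ⊗₁ (θ a₂ b₁ b₂ ⊗₁ id)) ▸ (id ⊗₁ α b₁ (a₂ ⊗₀ b₂) R)
          ▸ (id ⊗₁ (id ⊗₁ α a₂ b₂ R)) ▸ tail
      ∎
      where open HomReasoning

    middle≈rhs : middle ≈ (ex a₁ a₂ b₁ b₂ ⊗₁ id) ▸ ex (a₁ ⊗₀ b₁) (a₂ ⊗₀ b₂) d₁ d₂ ▸ (α a₁ b₁ d₁ ⊗₁ α a₂ b₂ d₂)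
    middle≈rhs = begin
        (α a₁ a₂ Q ⊗₁ id) ▸ α a₁ (a₂ ⊗₀ Q) R ▸ (id ⊗₁ (θ a₂ b₁ b₂ ⊗₁ id)) ▸ (id ⊗₁ α b₁ (a₂ ⊗₀ b₂) R)
          ▸ (id ⊗₁ (id ⊗₁ α a₂ b₂ R)) ▸ tail
      ≈⟨ ▹ prefix₂₂ (sym (α-nat _ _ _)) ⟩
        (α a₁ a₂ Q ⊗₁ id) ▸ ((id ⊗₁ θ a₂ b₁ b₂) ⊗₁ id) ▸ α a₁ (b₁ ⊗₀ (a₂ ⊗₀ b₂)) R ▸ (id ⊗₁ α b₁ (a₂ ⊗₀ b₂) R)
          ▸ (id ⊗₁ (id ⊗₁ α a₂ b₂ R)) ▸ tail
      ≈⟨ ▹ ▹ prefix₃₂ (pentagon-α⁻¹⊗id▸α▸α a₁ b₁ (a₂ ⊗₀ b₂) R) ⟨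
        (α a₁ a₂ Q ⊗₁ id) ▸ ((id ⊗₁ θ a₂ b₁ b₂) ⊗₁ id) ▸ (α⁻¹ a₁ b₁ (a₂ ⊗₀ b₂) ⊗₁ id)
          ▸ α (a₁ ⊗₀ b₁) (a₂ ⊗₀ b₂) R ▸ α a₁ b₁ ((a₂ ⊗₀ b₂) ⊗₀ R)
          ▸ (id ⊗₁ (id ⊗₁ α a₂ b₂ R)) ▸ tail
      ≈⟨ ▹ ▹ ▹ ▹ (▹ ▹ prefix₂₂ (α-natʳ _) ∙ ▹ prefix₂₂ (α-natʳ _) ∙ prefix₂₂ (α-natʳ _)) ⟨
        (α a₁ a₂ Q ⊗₁ id) ▸ ((id ⊗₁ θ a₂ b₁ b₂) ⊗₁ id) ▸ (α⁻¹ a₁ b₁ (a₂ ⊗₀ b₂) ⊗₁ id)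
          ▸ α (a₁ ⊗₀ b₁) (a₂ ⊗₀ b₂) R ▸ (id ⊗₁ α a₂ b₂ R) ▸ (id ⊗₁ (id ⊗₁ θ b₂ d₁ d₂))
          ▸ (id ⊗₁ θ a₂ d₁ D) ▸ α a₁ b₁ (d₁ ⊗₀ (a₂ ⊗₀ D))
          ▸ (id ⊗₁ α⁻¹ b₁ d₁ (a₂ ⊗₀ D)) ▸ α⁻¹ a₁ B (a₂ ⊗₀ D)
      ≈⟨ ▹ ▹ ▹ ▹ ▹ ▹ ▹ reassociate ⟨
        (α a₁ a₂ Q ⊗₁ id) ▸ ((id ⊗₁ θ a₂ b₁ b₂) ⊗₁ id) ▸ (α⁻¹ a₁ b₁ (a₂ ⊗₀ b₂) ⊗₁ id)
          ▸ α (a₁ ⊗₀ b₁) (a₂ ⊗₀ b₂) R ▸ (id ⊗₁ α a₂ b₂ R) ▸ (id ⊗₁ (id ⊗₁ θ b₂ d₁ d₂))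
          ▸ (id ⊗₁ θ a₂ d₁ D) ▸ (id ⊗₁ (id ⊗₁ α⁻¹ a₂ b₂ d₂))
          ▸ α⁻¹ (a₁ ⊗₀ b₁) d₁ ((a₂ ⊗₀ b₂) ⊗₀ d₂) ▸ (α a₁ b₁ d₁ ⊗₁ α a₂ b₂ d₂)
      ≈⟨ ▹ ▹ ▹ ▹ prefix₁₄ (refl ⟩⊗⟨ θ-⊗₁ a₂ b₂ d₁ d₂ ∙ id⊗-⨾ ∙ ▹ id⊗-⨾ ∙ ▹ ▹ id⊗-⨾) ⟨
        (α a₁ a₂ Q ⊗₁ id) ▸ ((id ⊗₁ θ a₂ b₁ b₂) ⊗₁ id) ▸ (α⁻¹ a₁ b₁ (a₂ ⊗₀ b₂) ⊗₁ id)
          ▸ α (a₁ ⊗₀ b₁) (a₂ ⊗₀ b₂) R ▸ (id ⊗₁ θ (a₂ ⊗₀ b₂) d₁ d₂)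
          ▸ α⁻¹ (a₁ ⊗₀ b₁) d₁ ((a₂ ⊗₀ b₂) ⊗₀ d₂) ▸ (α a₁ b₁ d₁ ⊗₁ α a₂ b₂ d₂)
      ≈⟨ prefix₁₃ (ex-unfold ⟩⊗⟨ refl ∙ ⊗id-⨾ ∙ ▹ ⊗id-⨾) ∙ ▹ ▹ ▹ prefix₁₃ ex-unfold ⟨
        (ex a₁ a₂ b₁ b₂ ⊗₁ id) ▸ ex (a₁ ⊗₀ b₁) (a₂ ⊗₀ b₂) d₁ d₂ ▸ (α a₁ b₁ d₁ ⊗₁ α a₂ b₂ d₂)
      ∎
      where
        open HomReasoning
        reassociate : (id ⊗₁ (id ⊗₁ α⁻¹ a₂ b₂ d₂)) ▸ α⁻¹ (a₁ ⊗₀ b₁) d₁ ((a₂ ⊗₀ b₂) ⊗₀ d₂)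
                        ▸ (α a₁ b₁ d₁ ⊗₁ α a₂ b₂ d₂)
                      ≈ α a₁ b₁ (d₁ ⊗₀ (a₂ ⊗₀ D)) ▸ (id ⊗₁ α⁻¹ b₁ d₁ (a₂ ⊗₀ D)) ▸ α⁻¹ a₁ B (a₂ ⊗₀ D)
        reassociate = prefix₂₂ (α⁻¹-nat _ _ _) ∙ ▹ (sym ⊗-⨾ ∙ (⊗-id ⟩⨾⟨refl ∙ idˡ _) ⟩⊗⟨ α-iso₂ _ _ _)
          ∙ pentagon-α⁻¹▸α⊗id a₁ b₁ d₁ (a₂ ⊗₀ D)

  ex-α : ∀ a₁ a₂ b₁ b₂ d₁ d₂ →
    α (a₁ ⊗₀ a₂) (b₁ ⊗₀ b₂) (d₁ ⊗₀ d₂) ▸ (id ⊗₁ ex b₁ b₂ d₁ d₂) ▸ ex a₁ a₂ (b₁ ⊗₀ d₁) (b₂ ⊗₀ d₂)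
    ≈ (ex a₁ a₂ b₁ b₂ ⊗₁ id) ▸ ex (a₁ ⊗₀ b₁) (a₂ ⊗₀ b₂) d₁ d₂ ▸ (α a₁ b₁ d₁ ⊗₁ α a₂ b₂ d₂)
  ex-α a₁ a₂ b₁ b₂ d₁ d₂ =
    lhs≈middle ∙ middle≈rhs
    where open ExAssociativity a₁ a₂ b₁ b₂ d₁ d₂

module Restriction {o h e p} {C : CatData o h e} (isCategory : IsCategory C)
                   (P : ∀ {A B} → CatData.Hom C A B → Set p) where
  open CatData C
  open Sub C P

  SubCat-isCategory : (cl : CatClosed) → IsCategory (SubCat cl)
  SubCat-isCategory cl = record
    { equiv = record
      { refl = IsEquivalence.refl equiv ; sym = IsEquivalence.sym equiv ; trans = IsEquivalence.trans equiv }
    ; ⨾-resp = ⨾-resp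
    ; assoc = λ f g k → assoc (proj₁ f) (proj₁ g) (proj₁ k)
    ; idˡ = λ f → idˡ (proj₁ f)
    ; idʳ = λ f → idʳ (proj₁ f)
    }
    where open IsCategory isCategory

  restrictSM-isSymMon : (cl : CatClosed) (M : SymMonData C) (s : SymMonClosed M) →
                        IsSymMon M → IsSymMon (restrictSM cl M s)
  restrictSM-isSymMon cl M s isM = record
    { ⊗-resp = ⊗-resp
    ; ⊗-id = ⊗-id
    ; ⊗-comp = λ f g f' g' → ⊗-comp (proj₁ f) (proj₁ g) (proj₁ f') (proj₁ g')
    ; α-nat = λ f g k → α-nat (proj₁ f) (proj₁ g) (proj₁ k)
    ; lu-nat = λ f → lu-nat (proj₁ f)
    ; ru-nat = λ f → ru-nat (proj₁ f)
    ; σ-nat = λ f g → σ-nat (proj₁ f) (proj₁ g)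
    ; α-iso₁ = α-iso₁ ; α-iso₂ = α-iso₂ ; lu-iso₁ = lu-iso₁ ; lu-iso₂ = lu-iso₂
    ; ru-iso₁ = ru-iso₁ ; ru-iso₂ = ru-iso₂ ; σ-invol = σ-invol
    ; pentagon = pentagon ; triangle = triangle ; hexagon = hexagon
    }
    where open IsSymMon isM

  module _ (R : RigOps C) (cl : RigOpsClosed R) where
    open RigOpsClosed cl
    private R' = restrictRigOps R cl

    restrictRigOps-isRig : IsRig (RigOps.rig R) → IsRig (RigOps.rig R')
    restrictRigOps-isRig isR = record
      { isCategory = SubCat-isCategory catClosed
      ; isSymMon⊗ = restrictSM-isSymMon catClosed _ timesClosed isSymMon⊗
      ; isSymMon⊕ = restrictSM-isSymMon catClosed _ plusClosed isSymMon⊕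
      ; δl-nat = λ f g k → δl-nat (proj₁ f) (proj₁ g) (proj₁ k)
      ; δr-nat = λ f g k → δr-nat (proj₁ f) (proj₁ g) (proj₁ k)
      ; λ•-nat = λ f → λ•-nat (proj₁ f)
      ; ρ•-nat = λ f → ρ•-nat (proj₁ f)
      ; δl-iso₁ = δl-iso₁ ; δl-iso₂ = δl-iso₂ ; δr-iso₁ = δr-iso₁ ; δr-iso₂ = δr-iso₂
      ; λ•-iso₁ = λ•-iso₁ ; λ•-iso₂ = λ•-iso₂ ; ρ•-iso₁ = ρ•-iso₁ ; ρ•-iso₂ = ρ•-iso₂
      ; laplaza-I = laplaza-I ; laplaza-II = laplaza-II ; laplaza-III = laplaza-III
      ; laplaza-IV = laplaza-IV ; laplaza-V = laplaza-V ; laplaza-VI = laplaza-VI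
      ; laplaza-VII = laplaza-VII ; laplaza-VIII = laplaza-VIII ; laplaza-IX = laplaza-IX
      ; laplaza-X = laplaza-X ; laplaza-XI = laplaza-XI ; laplaza-XII = laplaza-XII
      ; laplaza-XIII = laplaza-XIII ; laplaza-XIV = laplaza-XIV ; laplaza-XV = laplaza-XV
      ; laplaza-XVI = laplaza-XVI ; laplaza-XVII = laplaza-XVII ; laplaza-XVIII = laplaza-XVIII
      ; laplaza-XIX = laplaza-XIX ; laplaza-XX = laplaza-XX ; laplaza-XXI = laplaza-XXI
      ; laplaza-XXII = laplaza-XXII
      }
      where open IsRig isR

    restrictRigOps-isFc : IsFc (RigOps.plus R) (RigOps.mon R) → IsFc (RigOps.plus R') (RigOps.mon R')
    restrictRigOps-isFc isF = record
      { isSymMon = restrictSM-isSymMon catClosed _ plusClosed isSymMon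
      ; ∇-assoc = ∇-assoc ; ∇-unitˡ = ∇-unitˡ ; ∇-unitʳ = ∇-unitʳ ; ∇-comm = ∇-comm
      ; ∇-nat = λ f → ∇-nat (proj₁ f)
      ; ¡-nat = λ f → ¡-nat (proj₁ f)
      ; ∇-⊗ = ∇-⊗ ; ¡-⊗ = ¡-⊗ ; ∇-I = ∇-I ; ¡-I = ¡-I
      }
      where open IsFc isF

    restrictRigOps-isCd : IsCd (RigOps.times R) (RigOps.comon R) → IsCd (RigOps.times R') (RigOps.comon R')
    restrictRigOps-isCd isD = record
      { isSymMon = restrictSM-isSymMon catClosed _ timesClosed isSymMon
      ; copy-assoc = copy-assoc ; copy-unitˡ = copy-unitˡ ; copy-unitʳ = copy-unitʳ
      ; copy-comm = copy-comm ; copy-⊗ = copy-⊗ ; disc-⊗ = disc-⊗ ; copy-I = copy-I ; disc-I = disc-I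
      }
      where open IsCd isD


module CdCategory {o h e} {C : CatData o h e} (isCategory : IsCategory C)
                  {M : SymMonData C} {c : ComonoidOps M} (isCd : IsCd M c) where
  open CatData C
  open IsCategory isCategory
  open CategoryReasoning isCategory
  open SymMonData M
  open ComonoidOps c
  module Cd = IsCd isCd
  module ⊗ = SymmetricMonoidal isCategory Cd.isSymMon
  open ⊗ using (_⟩⊗⟨_)

  Det Tot Map : ∀ {X Y} → Hom X Y → Set e
  Det {X} {Y} f = f ⨾ copy Y ≈ copy X ⨾ (f ⊗₁ f)
  Tot {X} {Y} f = f ⨾ disc Y ≈ disc X
  Map f = Det f × Tot f

  det-id : ∀ {X} → Det (id {X})
  det-id = idˡ _ ∙ sym (▹ ⊗.⊗-id ∙ idʳ _)
  tot-id : ∀ {X} → Tot (id {X})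
  tot-id = idˡ _
  det-⨾ : ∀ {X Y Z} {f : Hom X Y} {g : Hom Y Z} → Det f → Det g → Det (f ⨾ g)
  det-⨾ df dg = assocʳ ∙ ▹ dg ∙ assocˡ ∙ df ⟩⨾⟨refl ∙ assocʳ ∙ ▹ sym ⊗.⊗-⨾
  tot-⨾ : ∀ {X Y Z} {f : Hom X Y} {g : Hom Y Z} → Tot f → Tot g → Tot (f ⨾ g)
  tot-⨾ tf tg = assocʳ ∙ ▹ tg ∙ tf
  det-resp : ∀ {X Y} {f g : Hom X Y} → f ≈ g → Det f → Det g
  det-resp p df = sym p ⟩⨾⟨refl ∙ df ∙ ▹ (p ⟩⊗⟨ p)
  tot-resp : ∀ {X Y} {f g : Hom X Y} → f ≈ g → Tot f → Tot g
  tot-resp p tf = sym p ⟩⨾⟨refl ∙ tf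
  det-inv : ∀ {X Y} {f : Hom X Y} {g : Hom Y X} → f ⨾ g ≈ id → g ⨾ f ≈ id → Det f → Det g
  det-inv {f = f} {g} fg gf df =
    switchʳ (⊗.⊗-iso fg fg) (assocʳ ∙ ▹ sym df ∙ assocˡ ∙ gf ⟩⨾⟨refl ∙ idˡ _)
  tot-inv : ∀ {X Y} {f : Hom X Y} {g : Hom Y X} → g ⨾ f ≈ id → Tot f → Tot g
  tot-inv gf tf = ▹ sym tf ∙ assocˡ ∙ gf ⟩⨾⟨refl ∙ idˡ _
  det-⊗ : ∀ {X Y X' Y'} {f : Hom X Y} {g : Hom X' Y'} → Det f → Det g → Det (f ⊗₁ g)
  det-⊗ {f = f} {g} df dg =
    ▹ Cd.copy-⊗ _ _ ∙ assocˡ ∙ (sym ⊗.⊗-⨾ ∙ df ⟩⊗⟨ dg ∙ ⊗.⊗-⨾) ⟩⨾⟨refl ∙ assocʳ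
    ∙ ▹ ⊗.ex-nat f f g g ∙ assocˡ ∙ sym (Cd.copy-⊗ _ _) ⟩⨾⟨refl
  tot-⊗ : ∀ {X Y X' Y'} {f : Hom X Y} {g : Hom X' Y'} → Tot f → Tot g → Tot (f ⊗₁ g)
  tot-⊗ tf tg = ▹ Cd.disc-⊗ _ _ ∙ assocˡ ∙ (sym ⊗.⊗-⨾ ∙ tf ⟩⊗⟨ tg) ⟩⨾⟨refl ∙ sym (Cd.disc-⊗ _ _)

  σ-I-I : σ I I ≈ id
  σ-I-I = sym (cancelˡ (⊗.lu-iso₁ I)) ∙ ▹ (sym Cd.copy-I ⟩⨾⟨refl ∙ Cd.copy-comm I ∙ Cd.copy-I) ∙ ⊗.lu-iso₁ I
  luI≈ruI : lu I ≈ ru I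
  luI≈ruI = sym (idʳ _) ∙ ▹ sym lu⁻¹⨾ru ∙ assocˡ ∙ ⊗.lu-iso₁ I ⟩⨾⟨refl ∙ idˡ _
    where
      lu⁻¹⨾ru : lu⁻¹ I ⨾ ru I ≈ id
      lu⁻¹⨾ru = sym Cd.copy-I ⟩⨾⟨refl ∙ sym (▹ (refl ⟩⊗⟨ Cd.disc-I ∙ ⊗.⊗-id) ∙ idʳ _) ⟩⨾⟨refl ∙ Cd.copy-unitʳ I
  lu⁻¹I≈ru⁻¹I : lu⁻¹ I ≈ ru⁻¹ I
  lu⁻¹I≈ru⁻¹I = inverse-unique (⊗.lu-iso₂ I) (⊗.ru-iso₁ I) luI≈ruI

  tot-lu : ∀ A → Tot (lu A)
  tot-lu A = sym (⊗.lu-nat _) ∙ (sym Cd.disc-I ⟩⊗⟨ refl) ⟩⨾⟨refl ∙ sym (Cd.disc-⊗ _ _)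
  tot-ru : ∀ A → Tot (ru A)
  tot-ru A = sym (⊗.ru-nat _) ∙ (refl ⟩⊗⟨ sym Cd.disc-I) ⟩⨾⟨ sym luI≈ruI ∙ sym (Cd.disc-⊗ _ _)
  tot-σ : ∀ A B → Tot (σ A B)
  tot-σ A B = ▹ Cd.disc-⊗ _ _ ∙ assocˡ ∙ sym (⊗.σ-nat _ _) ⟩⨾⟨refl ∙ assocʳ ∙ ▹ (σ-I-I ⟩⨾⟨refl ∙ idˡ _)
    ∙ sym (Cd.disc-⊗ _ _)
  tot-α : ∀ A B D → Tot (α A B D)
  tot-α A B D =
      ▹ (Cd.disc-⊗ _ _ ∙ (refl ⟩⊗⟨ Cd.disc-⊗ _ _ ∙ sym (idʳ _) ⟩⊗⟨ refl ∙ ⊗.⊗-⨾) ⟩⨾⟨refl)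
    ∙ assocˡ ∙ (assocˡ ∙ sym (⊗.α-nat _ _ _) ⟩⨾⟨refl) ⟩⨾⟨refl ∙ (assocʳ ∙ ▹ ⊗.triangle I I) ⟩⨾⟨refl
    ∙ (▹ (sym luI≈ruI ⟩⊗⟨ refl)) ⟩⨾⟨refl
    ∙ sym (refl ⟩⊗⟨ sym (idʳ _) ∙ ⊗.⊗-⨾) ⟩⨾⟨refl
    ∙ (sym (Cd.disc-⊗ _ _) ⟩⊗⟨ refl) ⟩⨾⟨refl ∙ sym (Cd.disc-⊗ _ _)

  det-lu : ∀ A → Det (lu A)
  det-lu A = sym (begin
      copy (I ⊗₀ A) ⨾ (lu A ⊗₁ lu A)
    ≈⟨ Cd.copy-⊗ _ _ ⟩⨾⟨refl ∙ ((Cd.copy-I ∙ lu⁻¹I≈ru⁻¹I) ⟩⊗⟨ refl ∙ ⊗.serialize₂₁) ⟩⨾⟨refl ⟩⨾⟨refl ⟩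
      (((id ⊗₁ copy A) ⨾ (ru⁻¹ I ⊗₁ id)) ⨾ ex I I A A) ⨾ (lu A ⊗₁ lu A)
    ≈⟨ assocʳ ⟩⨾⟨refl ∙ assocʳ ∙ ▹ (assocʳ ∙ ⊗.ex-unit A A) ⟩
      (id ⊗₁ copy A) ⨾ lu (A ⊗₀ A)
    ≈⟨ ⊗.lu-nat _ ⟩
      lu A ⨾ copy A
    ∎)
    where open HomReasoning
  det-σ : ∀ A B → Det (σ A B)
  det-σ A B = ▹ Cd.copy-⊗ _ _ ∙ assocˡ ∙ sym (⊗.σ-nat _ _) ⟩⨾⟨refl ∙ assocʳ ∙ ▹ ⊗.ex-σ A A B B
    ∙ assocˡ ∙ sym (Cd.copy-⊗ _ _) ⟩⨾⟨refl
  det-ru : ∀ A → Det (ru A)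
  det-ru A = det-resp (⊗.σ-lu A) (det-⨾ (det-σ A I) (det-lu A))
  det-α : ∀ A B D → Det (α A B D)
  det-α A B D = begin
      α A B D ⨾ copy (A ⊗₀ (B ⊗₀ D))
    ≈⟨ ▹ (Cd.copy-⊗ _ _ ∙ (refl ⟩⊗⟨ Cd.copy-⊗ _ _ ∙ sym (idʳ _) ⟩⊗⟨ refl ∙ ⊗.⊗-⨾) ⟩⨾⟨refl ∙ assocʳ)
       ∙ assocˡ ∙ sym (⊗.α-nat _ _ _) ⟩⨾⟨refl ∙ assocʳ ⟩
      ((copy A ⊗₁ copy B) ⊗₁ copy D) ▸ α (A ⊗₀ A) (B ⊗₀ B) (D ⊗₀ D) ▸ (id ⊗₁ ex B B D D)
        ▸ ex A A (B ⊗₀ D) (B ⊗₀ D)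
    ≈⟨ ▹ ⊗.ex-α A A B B D D ⟩
      ((copy A ⊗₁ copy B) ⊗₁ copy D) ▸ (ex A A B B ⊗₁ id) ▸ ex (A ⊗₀ B) (A ⊗₀ B) D D ▸ (α A B D ⊗₁ α A B D)
    ≈⟨ prefix₂₁ (sym ⊗.⊗-⨾ ∙ sym (Cd.copy-⊗ _ _) ⟩⊗⟨ idʳ _) ∙ assocˡ ∙ sym (Cd.copy-⊗ _ _) ⟩⨾⟨refl ⟩
      copy ((A ⊗₀ B) ⊗₀ D) ⨾ (α A B D ⊗₁ α A B D)
    ∎
    where open HomReasoning

  copy-assoc▸ : ∀ X → copy X ▸ (copy X ⊗₁ id) ▸ α X X X ≈ copy X ▸ (id ⊗₁ copy X)
  copy-assoc▸ X = assocˡ ∙ Cd.copy-assoc X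
  copy-assoc⁻¹ : ∀ X → copy X ▸ (id ⊗₁ copy X) ▸ α⁻¹ X X X ≈ copy X ▸ (copy X ⊗₁ id)
  copy-assoc⁻¹ X = assocˡ ∙ sym (copy-assoc▸ X) ⟩⨾⟨refl ∙ assocʳ ∙ ▹ (assocʳ ∙ ▹ ⊗.α-iso₁ _ _ _ ∙ idʳ _)
  copy-θ : ∀ X → copy X ▸ (id ⊗₁ copy X) ▸ ⊗.θ X X X ≈ copy X ▸ (id ⊗₁ copy X)
  copy-θ X = ▹ ▹ ⊗.θ-unfold ∙ prefix₃₁ (copy-assoc⁻¹ X) ∙ assocʳ
    ∙ ▹ prefix₂₁ (sym ⊗.⊗id-⨾ ∙ Cd.copy-comm X ⟩⊗⟨ refl) ∙ copy-assoc▸ X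
  det-copy : ∀ X → Det (copy X)
  det-copy X = begin
      copy X ⨾ copy (X ⊗₀ X)
    ≈⟨ ▹ (Cd.copy-⊗ _ _ ∙ ⊗.serialize₁₂ ⟩⨾⟨ ⊗.ex-unfold) ∙ ▹ assocʳ ⟩
      copy X ▸ (copy X ⊗₁ id) ▸ (id ⊗₁ copy X) ▸ α X X (X ⊗₀ X) ▸ (id ⊗₁ ⊗.θ X X X) ▸ α⁻¹ X X (X ⊗₀ X)
    ≈⟨ ▹ ▹ prefix₂₂ (⊗.α-natʳ _) ∙ prefix₃₂ (copy-assoc▸ X) ⟩
      copy X ▸ (id ⊗₁ copy X) ▸ (id ⊗₁ (id ⊗₁ copy X)) ▸ (id ⊗₁ ⊗.θ X X X) ▸ α⁻¹ X X (X ⊗₀ X)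
    ≈⟨ ▹ prefix₃₂ (sym (⊗.id⊗-⨾ ∙ ▹ ⊗.id⊗-⨾) ∙ refl ⟩⊗⟨ copy-θ X ∙ ⊗.id⊗-⨾) ⟩
      copy X ▸ (id ⊗₁ copy X) ▸ (id ⊗₁ (id ⊗₁ copy X)) ▸ α⁻¹ X X (X ⊗₀ X)
    ≈⟨ ▹ ▹ ⊗.α⁻¹-natʳ _ ∙ prefix₃₂ (copy-assoc⁻¹ X) ∙ ▹ sym ⊗.serialize₁₂ ⟩
      copy X ⨾ (copy X ⊗₁ copy X)
    ∎
    where open HomReasoning
  tot-copy : ∀ X → Tot (copy X)
  tot-copy X = ▹ (Cd.disc-⊗ _ _ ∙ ⊗.serialize₁₂ ⟩⨾⟨refl ∙ assocʳ ∙ ▹ ⊗.lu-nat _) ∙ assocˡ ∙ assocˡ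
             ∙ Cd.copy-unitˡ X ⟩⨾⟨refl ∙ idˡ _
  det-disc : ∀ X → Det (disc X)
  det-disc X =
    sym (▹ (⊗.serialize₁₂ ∙ ▹ switchʳ (⊗.lu-iso₁ I) (⊗.lu-nat _)) ∙ assocˡ ∙ assocˡ ∙ counit ∙ sym (▹ Cd.copy-I))
    where
      counit : ((copy X ⨾ (disc X ⊗₁ id)) ⨾ (lu X ⨾ disc X)) ⨾ lu⁻¹ I ≈ disc X ⨾ lu⁻¹ I
      counit = (assocˡ ∙ Cd.copy-unitˡ X ⟩⨾⟨refl ∙ idˡ _) ⟩⨾⟨refl
  tot-disc : ∀ X → Tot (disc X)
  tot-disc X = ▹ Cd.disc-I ∙ idʳ _

  map-id : ∀ {X} → Map (id {X})
  map-id = det-id , tot-id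
  map-⨾ : ∀ {X Y Z} {f : Hom X Y} {g : Hom Y Z} → Map f → Map g → Map (f ⨾ g)
  map-⨾ (a , b) (c , d) = det-⨾ a c , tot-⨾ b d
  map-resp : ∀ {X Y} {f g : Hom X Y} → f ≈ g → Map f → Map g
  map-resp p (a , b) = det-resp p a , tot-resp p b
  map-inv : ∀ {X Y} {f : Hom X Y} {g : Hom Y X} → f ⨾ g ≈ id → g ⨾ f ≈ id → Map f → Map g
  map-inv fg gf (a , b) = det-inv fg gf a , tot-inv gf b
  map-⊗ : ∀ {X Y X' Y'} {f : Hom X Y} {g : Hom X' Y'} → Map f → Map g → Map (f ⊗₁ g)
  map-⊗ (a , b) (c , d) = det-⊗ a c , tot-⊗ b d
  map-α : ∀ A B D → Map (α A B D)
  map-α A B D = det-α A B D , tot-α A B D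
  map-lu : ∀ A → Map (lu A)
  map-lu A = det-lu A , tot-lu A
  map-ru : ∀ A → Map (ru A)
  map-ru A = det-ru A , tot-ru A
  map-σ : ∀ A B → Map (σ A B)
  map-σ A B = det-σ A B , tot-σ A B

  map-copy : ∀ X → Map (copy X)
  map-copy X = det-copy X , tot-copy X
  map-disc : ∀ X → Map (disc X)
  map-disc X = det-disc X , tot-disc X

module FcCdRig {o h e} (𝒞 : FcCdRigCategory o h e) where
  open FcCdRigCategory 𝒞
  open IsFcCdRig isFcCdRig
  open IsRig isRig
  open IsCategory isCategory
  open CategoryReasoning isCategory
  module ⊕ = SymmetricMonoidal isCategory isSymMon⊕
  module Fc = IsFc isFc
  open CdCategory isCategory isCd
  open ⊗ using (_⟩⊗⟨_)

  infixr 10 _⟩⊕⟨_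
  _⟩⊕⟨_ : ∀ {A B A' B'} {f g : Hom A B} {f' g' : Hom A' B'} → f ≈ g → f' ≈ g' → (f ⊕₁ f') ≈ (g ⊕₁ g')
  _⟩⊕⟨_ = ⊕._⟩⊗⟨_

  from-O-unique : ∀ {Z} (f g : Hom O Z) → f ≈ g
  from-O-unique f g =
    sym (idˡ f) ∙ sym Fc.¡-I ⟩⨾⟨refl ∙ Fc.¡-nat f ∙ sym (Fc.¡-nat g) ∙ Fc.¡-I ⟩⨾⟨refl ∙ idˡ g
  from-retract-of-O-unique : ∀ {X Z} (i : Hom X O) (j : Hom O X) → i ⨾ j ≈ id → (f g : Hom X Z) → f ≈ g
  from-retract-of-O-unique i j ij f g =
    sym (idˡ f) ∙ sym ij ⟩⨾⟨refl ∙ assocʳ ∙ ▹ from-O-unique _ _ ∙ assocˡ ∙ ij ⟩⨾⟨refl ∙ idˡ g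
  from-O⊗-unique : ∀ {A Z} (f g : Hom (O ⊗₀ A) Z) → f ≈ g
  from-O⊗-unique = from-retract-of-O-unique (λ• _) (λ•⁻¹ _) (λ•-iso₁ _)
  from-⊗O-unique : ∀ {A Z} (f g : Hom (A ⊗₀ O) Z) → f ≈ g
  from-⊗O-unique = from-retract-of-O-unique (ρ• _) (ρ•⁻¹ _) (ρ•-iso₁ _)
  from-O⊕O-unique : ∀ {Z} (f g : Hom (O ⊕₀ O) Z) → f ≈ g
  from-O⊕O-unique = from-retract-of-O-unique (lu⊕ _) (lu⊕⁻¹ _) (⊕.lu-iso₁ _)
  det-from-O : ∀ {Y} (f : Hom O Y) → Det f
  det-from-O f = from-O-unique _ _
  tot-from-O : ∀ {Y} (f : Hom O Y) → Tot f
  tot-from-O f = from-O-unique _ _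

  ι₁ : ∀ A B → Hom A (A ⊕₀ B)
  ι₁ A B = ru⊕⁻¹ A ⨾ (id ⊕₁ ¡ B)
  ι₂ : ∀ A B → Hom B (A ⊕₀ B)
  ι₂ A B = lu⊕⁻¹ B ⨾ (¡ A ⊕₁ id)

  ι₁-via-ru⊕⁻¹ : ∀ {A A'} B (f : Hom A A') → ru⊕⁻¹ A ⨾ (f ⊕₁ ¡ B) ≈ f ⨾ ι₁ A' B
  ι₁-via-ru⊕⁻¹ B f = ▹ ⊕.serialize₁₂ ∙ assocˡ ∙ sym (⊕.ru⁻¹-nat f) ⟩⨾⟨refl ∙ assocʳ
  ι₂-via-lu⊕⁻¹ : ∀ {B B'} A (f : Hom B B') → lu⊕⁻¹ B ⨾ (¡ A ⊕₁ f) ≈ f ⨾ ι₂ A B'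
  ι₂-via-lu⊕⁻¹ A f = ▹ ⊕.serialize₂₁ ∙ assocˡ ∙ sym (⊕.lu⁻¹-nat f) ⟩⨾⟨refl ∙ assocʳ
  ι₁-nat : ∀ {A B A' B'} (f : Hom A A') (g : Hom B B') → ι₁ A B ⨾ (f ⊕₁ g) ≈ f ⨾ ι₁ A' B'
  ι₁-nat f g = assocʳ ∙ ▹ (sym ⊕.⊗-⨾ ∙ idˡ _ ⟩⊕⟨ Fc.¡-nat g) ∙ ι₁-via-ru⊕⁻¹ _ f
  ι₂-nat : ∀ {A B A' B'} (f : Hom A A') (g : Hom B B') → ι₂ A B ⨾ (f ⊕₁ g) ≈ g ⨾ ι₂ A' B'
  ι₂-nat f g = assocʳ ∙ ▹ (sym ⊕.⊗-⨾ ∙ Fc.¡-nat f ⟩⊕⟨ idˡ _) ∙ ι₂-via-lu⊕⁻¹ _ g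
  ι₁⨾∇ : ∀ A → ι₁ A A ⨾ ∇ A ≈ id
  ι₁⨾∇ A = assocʳ ∙ ▹ Fc.∇-unitʳ A ∙ ⊕.ru-iso₂ A
  ι₂⨾∇ : ∀ A → ι₂ A A ⨾ ∇ A ≈ id
  ι₂⨾∇ A = assocʳ ∙ ▹ Fc.∇-unitˡ A ∙ ⊕.lu-iso₂ A
  ι₁-β : ∀ {A B Z} (f : Hom A Z) (g : Hom B Z) → ι₁ A B ⨾ ((f ⊕₁ g) ⨾ ∇ Z) ≈ f
  ι₁-β f g = assocˡ ∙ ι₁-nat f g ⟩⨾⟨refl ∙ assocʳ ∙ ▹ ι₁⨾∇ _ ∙ idʳ _
  ι₂-β : ∀ {A B Z} (f : Hom A Z) (g : Hom B Z) → ι₂ A B ⨾ ((f ⊕₁ g) ⨾ ∇ Z) ≈ g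
  ι₂-β f g = assocˡ ∙ ι₂-nat f g ⟩⨾⟨refl ∙ assocʳ ∙ ▹ ι₂⨾∇ _ ∙ idʳ _

  σ⊕-O-O : σ⊕ O O ≈ id
  σ⊕-O-O = from-O⊕O-unique _ _
  θ⊕-O-O : ∀ Y → ⊕.θ O O Y ≈ id
  θ⊕-O-O Y = (▹ (σ⊕-O-O ⟩⊕⟨ refl ∙ ⊕.⊗-id) ∙ idʳ _) ⟩⨾⟨refl ∙ ⊕.α-iso₂ _ _ _
  ex⊕-O-O : ∀ X Y → ex⊕ X O O Y ≈ id
  ex⊕-O-O X Y = (▹ (refl ⟩⊕⟨ θ⊕-O-O Y ∙ ⊕.⊗-id) ∙ idʳ _) ⟩⨾⟨refl ∙ ⊕.α-iso₁ _ _ _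
  ι₁⊕ι₂⨾∇ : ∀ X Y → (ι₁ X Y ⊕₁ ι₂ X Y) ⨾ ∇ (X ⊕₀ Y) ≈ id
  ι₁⊕ι₂⨾∇ X Y =
    ⊕.⊗-⨾ ⟩⨾⟨ Fc.∇-⊗ X Y ∙ assocʳ ∙ ▹ (assocˡ ∙ ⊕.ex-nat id (¡ Y) (¡ X) id ⟩⨾⟨refl ∙ assocʳ
    ∙ ex⊕-O-O X Y ⟩⨾⟨ (sym ⊕.⊗-⨾ ∙ Fc.∇-unitʳ X ⟩⊕⟨ Fc.∇-unitˡ Y) ∙ idˡ _)
    ∙ ⊕.⊗-iso (⊕.ru-iso₂ X) (⊕.lu-iso₂ Y)
  copair-η : ∀ {X Y Z} (f : Hom (X ⊕₀ Y) Z) → f ≈ ((ι₁ X Y ⨾ f) ⊕₁ (ι₂ X Y ⨾ f)) ⨾ ∇ Z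
  copair-η f = sym (idˡ f) ∙ sym (ι₁⊕ι₂⨾∇ _ _) ⟩⨾⟨refl ∙ assocʳ ∙ ▹ sym (Fc.∇-nat f)
    ∙ assocˡ ∙ sym ⊕.⊗-⨾ ⟩⨾⟨refl
  ι-jointly-epic : ∀ {X Y Z} {f g : Hom (X ⊕₀ Y) Z} →
                   ι₁ X Y ⨾ f ≈ ι₁ X Y ⨾ g → ι₂ X Y ⨾ f ≈ ι₂ X Y ⨾ g → f ≈ g
  ι-jointly-epic {f = f} {g} p q = copair-η f ∙ (p ⟩⊕⟨ q) ⟩⨾⟨refl ∙ sym (copair-η g)

  δl-ι₁ : ∀ X Y Z → (id {X} ⊗₁ ι₁ Y Z) ⨾ δl X Y Z ≈ ι₁ (X ⊗₀ Y) (X ⊗₀ Z)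
  δl-ι₁ X Y Z =
    ⊗.id⊗-⨾ ⟩⨾⟨refl ∙ assocʳ ∙ ▹ δl-nat id id (¡ Z) ∙ assocˡ
    ∙ ▹ (⊗.⊗-id ⟩⊕⟨ from-⊗O-unique _ (ρ• X ⨾ ¡ (X ⊗₀ Z)) ∙ sym (idˡ id) ⟩⊕⟨ refl ∙ ⊕.⊗-⨾)
    ∙ assocˡ ∙ laplaza-XX′ ⟩⨾⟨refl
    where
      laplaza-XX′ : (id ⊗₁ ru⊕⁻¹ Y) ⨾ δl X Y O ⨾ (id ⊕₁ ρ• X) ≈ ru⊕⁻¹ (X ⊗₀ Y)
      laplaza-XX′ = assocʳ ∙ ▹ switchʳ (⊕.ru-iso₁ _) (laplaza-XX X Y) ∙ cancelˡ (⊗.id⊗-iso (⊕.ru-iso₂ Y))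
  δl-ι₂ : ∀ X Y Z → (id {X} ⊗₁ ι₂ Y Z) ⨾ δl X Y Z ≈ ι₂ (X ⊗₀ Y) (X ⊗₀ Z)
  δl-ι₂ X Y Z =
    ⊗.id⊗-⨾ ⟩⨾⟨refl ∙ assocʳ ∙ ▹ δl-nat id (¡ Y) id ∙ assocˡ
    ∙ ▹ (from-⊗O-unique _ (ρ• X ⨾ ¡ (X ⊗₀ Y)) ⟩⊕⟨ (⊗.⊗-id ∙ sym (idˡ id)) ∙ ⊕.⊗-⨾)
    ∙ assocˡ ∙ laplaza-XIX′ ⟩⨾⟨refl
    where
      laplaza-XIX′ : (id ⊗₁ lu⊕⁻¹ Z) ⨾ δl X O Z ⨾ (ρ• X ⊕₁ id) ≈ lu⊕⁻¹ (X ⊗₀ Z)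
      laplaza-XIX′ = assocʳ ∙ ▹ switchʳ (⊕.lu-iso₁ _) (laplaza-XIX X Z) ∙ cancelˡ (⊗.id⊗-iso (⊕.lu-iso₂ Z))
  δr-ι₁ : ∀ X Y Z → (ι₁ X Y ⊗₁ id {Z}) ⨾ δr X Y Z ≈ ι₁ (X ⊗₀ Z) (Y ⊗₀ Z)
  δr-ι₁ X Y Z =
    ⊗.⊗id-⨾ ⟩⨾⟨refl ∙ assocʳ ∙ ▹ δr-nat id (¡ Y) id ∙ assocˡ
    ∙ ▹ (⊗.⊗-id ⟩⊕⟨ from-O⊗-unique _ (λ• Z ⨾ ¡ (Y ⊗₀ Z)) ∙ sym (idˡ id) ⟩⊕⟨ refl ∙ ⊕.⊗-⨾)
    ∙ assocˡ ∙ laplaza-XXII′ ⟩⨾⟨refl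
    where
      laplaza-XXII′ : (ru⊕⁻¹ X ⊗₁ id) ⨾ δr X O Z ⨾ (id ⊕₁ λ• Z) ≈ ru⊕⁻¹ (X ⊗₀ Z)
      laplaza-XXII′ = assocʳ ∙ ▹ switchʳ (⊕.ru-iso₁ _) (laplaza-XXII X Z) ∙ cancelˡ (⊗.⊗id-iso (⊕.ru-iso₂ X))
  δr-ι₂ : ∀ X Y Z → (ι₂ X Y ⊗₁ id {Z}) ⨾ δr X Y Z ≈ ι₂ (X ⊗₀ Z) (Y ⊗₀ Z)
  δr-ι₂ X Y Z =
    ⊗.⊗id-⨾ ⟩⨾⟨refl ∙ assocʳ ∙ ▹ δr-nat (¡ X) id id ∙ assocˡ
    ∙ ▹ (from-O⊗-unique _ (λ• Z ⨾ ¡ (X ⊗₀ Z)) ⟩⊕⟨ (⊗.⊗-id ∙ sym (idˡ id)) ∙ ⊕.⊗-⨾)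
    ∙ assocˡ ∙ laplaza-XXI′ ⟩⨾⟨refl
    where
      laplaza-XXI′ : (lu⊕⁻¹ Y ⊗₁ id) ⨾ δr O Y Z ⨾ (λ• Z ⊕₁ id) ≈ lu⊕⁻¹ (Y ⊗₀ Z)
      laplaza-XXI′ = assocʳ ∙ ▹ switchʳ (⊕.lu-iso₁ _) (laplaza-XXI Y Z) ∙ cancelˡ (⊗.⊗id-iso (⊕.lu-iso₂ Y))

  ι₁δl⁻¹ : ∀ X Y Z → ι₁ (X ⊗₀ Y) (X ⊗₀ Z) ⨾ δl⁻¹ X Y Z ≈ id ⊗₁ ι₁ Y Z
  ι₁δl⁻¹ X Y Z = sym (switchʳ (δl-iso₁ _ _ _) (δl-ι₁ X Y Z))
  ι₂δl⁻¹ : ∀ X Y Z → ι₂ (X ⊗₀ Y) (X ⊗₀ Z) ⨾ δl⁻¹ X Y Z ≈ id ⊗₁ ι₂ Y Z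
  ι₂δl⁻¹ X Y Z = sym (switchʳ (δl-iso₁ _ _ _) (δl-ι₂ X Y Z))
  ι₁δr⁻¹ : ∀ X Y Z → ι₁ (X ⊗₀ Z) (Y ⊗₀ Z) ⨾ δr⁻¹ X Y Z ≈ ι₁ X Y ⊗₁ id
  ι₁δr⁻¹ X Y Z = sym (switchʳ (δr-iso₁ _ _ _) (δr-ι₁ X Y Z))
  ι₂δr⁻¹ : ∀ X Y Z → ι₂ (X ⊗₀ Z) (Y ⊗₀ Z) ⨾ δr⁻¹ X Y Z ≈ ι₂ X Y ⊗₁ id
  ι₂δr⁻¹ X Y Z = sym (switchʳ (δr-iso₁ _ _ _) (δr-ι₂ X Y Z))

  det-ι₁ : ∀ X Y → Det (ι₁ X Y)
  det-ι₁ X Y = begin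
      ι₁ X Y ⨾ copy (X ⊕₀ Y)
    ≈⟨ ▹ copy-⊕ X Y ∙ assocˡ ∙ assocˡ ⟩⨾⟨refl ∙ assocˡ ⟩⨾⟨refl ⟩⨾⟨refl ⟩
      (((ι₁ X Y ⨾ (ru⊕⁻¹ X ⊕₁ lu⊕⁻¹ Y)) ⨾ ((copy X ⊕₁ ¡ (X ⊗₀ Y)) ⊕₁ (¡ (Y ⊗₀ X) ⊕₁ copy Y)))
         ⨾ (δl⁻¹ X X Y ⊕₁ δl⁻¹ Y X Y)) ⨾ δr⁻¹ X Y (X ⊕₀ Y)
    ≈⟨ ι₁-nat _ _ ⟩⨾⟨refl ⟩⨾⟨refl ⟩⨾⟨refl ⟩
      (((ru⊕⁻¹ X ⨾ ι₁ _ _) ⨾ ((copy X ⊕₁ ¡ (X ⊗₀ Y)) ⊕₁ (¡ (Y ⊗₀ X) ⊕₁ copy Y)))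
         ⨾ (δl⁻¹ X X Y ⊕₁ δl⁻¹ Y X Y)) ⨾ δr⁻¹ X Y (X ⊕₀ Y)
    ≈⟨ (assocʳ ∙ ▹ ι₁-nat _ _ ∙ assocˡ ∙ ι₁-via-ru⊕⁻¹ _ _ ⟩⨾⟨refl) ⟩⨾⟨refl ⟩⨾⟨refl ⟩
      (((copy X ⨾ ι₁ (X ⊗₀ X) (X ⊗₀ Y)) ⨾ ι₁ _ _) ⨾ (δl⁻¹ X X Y ⊕₁ δl⁻¹ Y X Y)) ⨾ δr⁻¹ X Y (X ⊕₀ Y)
    ≈⟨ (assocʳ ∙ ▹ ι₁-nat _ _) ⟩⨾⟨refl ∙ assocʳ ∙ assocʳ ∙ ▹ (▹ (assocʳ ∙ ▹ ι₁δr⁻¹ _ _ _)) ⟩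
      copy X ⨾ (ι₁ (X ⊗₀ X) (X ⊗₀ Y) ⨾ (δl⁻¹ X X Y ⨾ (ι₁ X Y ⊗₁ id)))
    ≈⟨ ▹ (assocˡ ∙ ι₁δl⁻¹ _ _ _ ⟩⨾⟨refl ∙ sym ⊗.serialize₂₁) ⟩
      copy X ⨾ (ι₁ X Y ⊗₁ ι₁ X Y)
    ∎
    where open HomReasoning
  det-ι₂ : ∀ X Y → Det (ι₂ X Y)
  det-ι₂ X Y = begin
      ι₂ X Y ⨾ copy (X ⊕₀ Y)
    ≈⟨ ▹ copy-⊕ X Y ∙ assocˡ ∙ assocˡ ⟩⨾⟨refl ∙ assocˡ ⟩⨾⟨refl ⟩⨾⟨refl ⟩
      (((ι₂ X Y ⨾ (ru⊕⁻¹ X ⊕₁ lu⊕⁻¹ Y)) ⨾ ((copy X ⊕₁ ¡ (X ⊗₀ Y)) ⊕₁ (¡ (Y ⊗₀ X) ⊕₁ copy Y)))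
         ⨾ (δl⁻¹ X X Y ⊕₁ δl⁻¹ Y X Y)) ⨾ δr⁻¹ X Y (X ⊕₀ Y)
    ≈⟨ ι₂-nat _ _ ⟩⨾⟨refl ⟩⨾⟨refl ⟩⨾⟨refl ⟩
      (((lu⊕⁻¹ Y ⨾ ι₂ _ _) ⨾ ((copy X ⊕₁ ¡ (X ⊗₀ Y)) ⊕₁ (¡ (Y ⊗₀ X) ⊕₁ copy Y)))
         ⨾ (δl⁻¹ X X Y ⊕₁ δl⁻¹ Y X Y)) ⨾ δr⁻¹ X Y (X ⊕₀ Y)
    ≈⟨ (assocʳ ∙ ▹ ι₂-nat _ _ ∙ assocˡ ∙ ι₂-via-lu⊕⁻¹ _ _ ⟩⨾⟨refl) ⟩⨾⟨refl ⟩⨾⟨refl ⟩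
      (((copy Y ⨾ ι₂ (Y ⊗₀ X) (Y ⊗₀ Y)) ⨾ ι₂ _ _) ⨾ (δl⁻¹ X X Y ⊕₁ δl⁻¹ Y X Y)) ⨾ δr⁻¹ X Y (X ⊕₀ Y)
    ≈⟨ (assocʳ ∙ ▹ ι₂-nat _ _) ⟩⨾⟨refl ∙ assocʳ ∙ assocʳ ∙ ▹ (▹ (assocʳ ∙ ▹ ι₂δr⁻¹ _ _ _)) ⟩
      copy Y ⨾ (ι₂ (Y ⊗₀ X) (Y ⊗₀ Y) ⨾ (δl⁻¹ Y X Y ⨾ (ι₂ X Y ⊗₁ id)))
    ≈⟨ ▹ (assocˡ ∙ ι₂δl⁻¹ _ _ _ ⟩⨾⟨refl ∙ sym ⊗.serialize₂₁) ⟩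
      copy Y ⨾ (ι₂ X Y ⊗₁ ι₂ X Y)
    ∎
    where open HomReasoning
  tot-ι₁ : ∀ X Y → Tot (ι₁ X Y)
  tot-ι₁ X Y = ▹ disc-⊕ X Y ∙ ι₁-β _ _
  tot-ι₂ : ∀ X Y → Tot (ι₂ X Y)
  tot-ι₂ X Y = ▹ disc-⊕ X Y ∙ ι₂-β _ _

  det-copair : ∀ {X Y Z} {f : Hom (X ⊕₀ Y) Z} → Det (ι₁ X Y ⨾ f) → Det (ι₂ X Y ⨾ f) → Det f
  det-copair {f = f} d1 d2 = ι-jointly-epic
    (assocˡ ∙ d1 ∙ ▹ ⊗.⊗-⨾ ∙ assocˡ ∙ sym (det-ι₁ _ _) ⟩⨾⟨refl ∙ assocʳ)
    (assocˡ ∙ d2 ∙ ▹ ⊗.⊗-⨾ ∙ assocˡ ∙ sym (det-ι₂ _ _) ⟩⨾⟨refl ∙ assocʳ)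
  tot-copair : ∀ {X Y Z} {f : Hom (X ⊕₀ Y) Z} → Tot (ι₁ X Y ⨾ f) → Tot (ι₂ X Y ⨾ f) → Tot f
  tot-copair t1 t2 = ι-jointly-epic (assocˡ ∙ t1 ∙ sym (tot-ι₁ _ _)) (assocˡ ∙ t2 ∙ sym (tot-ι₂ _ _))

  map-from-O : ∀ {Y} (f : Hom O Y) → Map f
  map-from-O f = det-from-O f , tot-from-O f
  map-ι₁ : ∀ X Y → Map (ι₁ X Y)
  map-ι₁ X Y = det-ι₁ X Y , tot-ι₁ X Y
  map-ι₂ : ∀ X Y → Map (ι₂ X Y)
  map-ι₂ X Y = det-ι₂ X Y , tot-ι₂ X Y
  map-copair : ∀ {X Y Z} {f : Hom (X ⊕₀ Y) Z} → Map (ι₁ X Y ⨾ f) → Map (ι₂ X Y ⨾ f) → Map f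
  map-copair (a , b) (c , d) = det-copair a c , tot-copair b d

  map-∇ : ∀ X → Map (∇ X)
  map-∇ X = map-copair (map-resp (sym (ι₁⨾∇ X)) map-id) (map-resp (sym (ι₂⨾∇ X)) map-id)
  map-⊕ : ∀ {X Y X' Y'} {f : Hom X Y} {g : Hom X' Y'} → Map f → Map g → Map (f ⊕₁ g)
  map-⊕ mf mg = map-copair (map-resp (sym (ι₁-nat _ _)) (map-⨾ mf (map-ι₁ _ _)))
                       (map-resp (sym (ι₂-nat _ _)) (map-⨾ mg (map-ι₂ _ _)))
  map-lu⊕ : ∀ X → Map (lu⊕ X)
  map-lu⊕ X = map-copair (map-from-O _)
    (map-resp (sym ((▹ (Fc.¡-I ⟩⊕⟨ refl ∙ ⊕.⊗-id) ∙ idʳ _) ⟩⨾⟨refl ∙ ⊕.lu-iso₂ X)) map-id)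
  map-ru⊕ : ∀ X → Map (ru⊕ X)
  map-ru⊕ X = map-copair
    (map-resp (sym ((▹ (refl ⟩⊕⟨ Fc.¡-I ∙ ⊕.⊗-id) ∙ idʳ _) ⟩⨾⟨refl ∙ ⊕.ru-iso₂ X)) map-id)
    (map-from-O _)
  map-σ⊕ : ∀ X Y → Map (σ⊕ X Y)
  map-σ⊕ X Y = map-copair
    (map-resp (sym (assocʳ ∙ ▹ ⊕.σ-nat _ _ ∙ assocˡ ∙ ⊕.ru⁻¹σ X ⟩⨾⟨refl)) (map-ι₂ _ _))
    (map-resp (sym (assocʳ ∙ ▹ ⊕.σ-nat _ _ ∙ assocˡ ∙ ⊕.lu⁻¹σ Y ⟩⨾⟨refl)) (map-ι₁ _ _))

  ι₁⨾ι₁ : ∀ X Y Z → ι₁ X Y ⨾ ι₁ (X ⊕₀ Y) Z ≈ ru⊕⁻¹ X ⨾ (ι₁ X Y ⊕₁ ¡ Z)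
  ι₁⨾ι₁ X Y Z = assocˡ ∙ ⊕.ru⁻¹-nat _ ⟩⨾⟨refl ∙ assocʳ ∙ ▹ sym ⊕.serialize₁₂
  ι₂⨾ι₁ : ∀ X Y Z → ι₂ X Y ⨾ ι₁ (X ⊕₀ Y) Z ≈ ru⊕⁻¹ Y ⨾ (ι₂ X Y ⊕₁ ¡ Z)
  ι₂⨾ι₁ X Y Z = assocˡ ∙ ⊕.ru⁻¹-nat _ ⟩⨾⟨refl ∙ assocʳ ∙ ▹ sym ⊕.serialize₁₂

  ι₁⨾ι₁⨾α⊕ : ∀ X Y Z → ι₁ X Y ⨾ (ι₁ (X ⊕₀ Y) Z ⨾ α⊕ X Y Z) ≈ ι₁ X (Y ⊕₀ Z)
  ι₁⨾ι₁⨾α⊕ X Y Z = begin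
      ι₁ X Y ⨾ (ι₁ (X ⊕₀ Y) Z ⨾ α⊕ X Y Z)
    ≈⟨ assocˡ ∙ ι₁⨾ι₁ X Y Z ⟩⨾⟨refl ∙ assocʳ ⟩
      ru⊕⁻¹ X ⨾ ((ι₁ X Y ⊕₁ ¡ Z) ⨾ α⊕ X Y Z)
    ≈⟨ ▹ ((refl ⟩⊕⟨ sym (idˡ _) ∙ ⊕.⊗-⨾) ⟩⨾⟨refl) ⟩
      ru⊕⁻¹ X ⨾ (((ru⊕⁻¹ X ⊕₁ id) ⨾ ((id ⊕₁ ¡ Y) ⊕₁ ¡ Z)) ⨾ α⊕ X Y Z)
    ≈⟨ ▹ (assocʳ ∙ ▹ ⊕.α-nat _ _ _ ∙ assocˡ ∙ ⊕.triangle⁻¹ X O ⟩⨾⟨refl ∙ sym ⊕.⊗-⨾) ⟩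
      ru⊕⁻¹ X ⨾ ((id ⨾ id) ⊕₁ (lu⊕⁻¹ O ⨾ (¡ Y ⊕₁ ¡ Z)))
    ≈⟨ ▹ (idˡ _ ⟩⊕⟨ from-O-unique _ _) ⟩
      ι₁ X (Y ⊕₀ Z)
    ∎
    where open HomReasoning
  ι₂⨾ι₁⨾α⊕ : ∀ X Y Z → ι₂ X Y ⨾ (ι₁ (X ⊕₀ Y) Z ⨾ α⊕ X Y Z) ≈ ι₁ Y Z ⨾ ι₂ X (Y ⊕₀ Z)
  ι₂⨾ι₁⨾α⊕ X Y Z = begin
      ι₂ X Y ⨾ (ι₁ (X ⊕₀ Y) Z ⨾ α⊕ X Y Z)
    ≈⟨ assocˡ ∙ ι₂⨾ι₁ X Y Z ⟩⨾⟨refl ∙ assocʳ ⟩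
      ru⊕⁻¹ Y ⨾ ((ι₂ X Y ⊕₁ ¡ Z) ⨾ α⊕ X Y Z)
    ≈⟨ ▹ ((refl ⟩⊕⟨ sym (idˡ _) ∙ ⊕.⊗-⨾) ⟩⨾⟨refl) ⟩
      ru⊕⁻¹ Y ⨾ (((lu⊕⁻¹ Y ⊕₁ id) ⨾ ((¡ X ⊕₁ id) ⊕₁ ¡ Z)) ⨾ α⊕ X Y Z)
    ≈⟨ ▹ (assocʳ ∙ ▹ ⊕.α-nat _ _ _ ∙ assocˡ ∙ ⊕.kelly-lu⁻¹ Y O ⟩⨾⟨refl) ⟩
      ru⊕⁻¹ Y ⨾ (lu⊕⁻¹ (Y ⊕₀ O) ⨾ (¡ X ⊕₁ (id ⊕₁ ¡ Z)))
    ≈⟨ ▹ (▹ (sym (idˡ _) ⟩⊕⟨ sym (idʳ _) ∙ ⊕.⊗-⨾) ∙ assocˡ) ∙ assocˡ ⟩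
      (ru⊕⁻¹ Y ⨾ (lu⊕⁻¹ (Y ⊕₀ O) ⨾ (id ⊕₁ (id ⊕₁ ¡ Z)))) ⨾ (¡ X ⊕₁ id)
    ≈⟨ (▹ sym (⊕.lu⁻¹-nat _) ∙ assocˡ) ⟩⨾⟨refl ∙ assocʳ ⟩
      ι₁ Y Z ⨾ ι₂ X (Y ⊕₀ Z)
    ∎
    where open HomReasoning
  ι₂⨾α⊕ : ∀ X Y Z → ι₂ (X ⊕₀ Y) Z ⨾ α⊕ X Y Z ≈ ι₂ Y Z ⨾ ι₂ X (Y ⊕₀ Z)
  ι₂⨾α⊕ X Y Z = begin
      (lu⊕⁻¹ Z ⨾ (¡ (X ⊕₀ Y) ⊕₁ id)) ⨾ α⊕ X Y Z
    ≈⟨ assocʳ ∙ ▹ ((Fc.¡-⊗ X Y ⟩⊕⟨ sym (idˡ _) ∙ ⊕.⊗-⨾) ⟩⨾⟨refl) ⟩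
      lu⊕⁻¹ Z ⨾ (((lu⊕⁻¹ O ⊕₁ id) ⨾ ((¡ X ⊕₁ ¡ Y) ⊕₁ id)) ⨾ α⊕ X Y Z)
    ≈⟨ ▹ (assocʳ ∙ ▹ ⊕.α-nat _ _ _ ∙ assocˡ ∙ ⊕.kelly-lu⁻¹ O Z ⟩⨾⟨refl) ⟩
      lu⊕⁻¹ Z ⨾ (lu⊕⁻¹ (O ⊕₀ Z) ⨾ (¡ X ⊕₁ (¡ Y ⊕₁ id)))
    ≈⟨ ▹ (▹ (sym (idˡ _) ⟩⊕⟨ sym (idʳ _) ∙ ⊕.⊗-⨾) ∙ assocˡ) ∙ assocˡ ⟩
      (lu⊕⁻¹ Z ⨾ (lu⊕⁻¹ (O ⊕₀ Z) ⨾ (id ⊕₁ (¡ Y ⊕₁ id)))) ⨾ (¡ X ⊕₁ id)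
    ≈⟨ (▹ sym (⊕.lu⁻¹-nat _) ∙ assocˡ) ⟩⨾⟨refl ∙ assocʳ ⟩
      ι₂ Y Z ⨾ ι₂ X (Y ⊕₀ Z)
    ∎
    where open HomReasoning

  map-α⊕ : ∀ X Y Z → Map (α⊕ X Y Z)
  map-α⊕ X Y Z = map-copair
    (map-copair (map-resp (sym (ι₁⨾ι₁⨾α⊕ X Y Z)) (map-ι₁ _ _))
                (map-resp (sym (ι₂⨾ι₁⨾α⊕ X Y Z)) (map-⨾ (map-ι₁ _ _) (map-ι₂ _ _))))
    (map-resp (sym (ι₂⨾α⊕ X Y Z)) (map-⨾ (map-ι₂ _ _) (map-ι₂ _ _)))

  map-δl⁻¹ : ∀ X Y Z → Map (δl⁻¹ X Y Z)
  map-δl⁻¹ X Y Z = map-copair (map-resp (sym (ι₁δl⁻¹ X Y Z)) (map-⊗ map-id (map-ι₁ _ _)))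
                          (map-resp (sym (ι₂δl⁻¹ X Y Z)) (map-⊗ map-id (map-ι₂ _ _)))
  map-δr⁻¹ : ∀ X Y Z → Map (δr⁻¹ X Y Z)
  map-δr⁻¹ X Y Z = map-copair (map-resp (sym (ι₁δr⁻¹ X Y Z)) (map-⊗ (map-ι₁ _ _) map-id))
                          (map-resp (sym (ι₂δr⁻¹ X Y Z)) (map-⊗ (map-ι₂ _ _) map-id))
  map-δl : ∀ X Y Z → Map (δl X Y Z)
  map-δl X Y Z = map-inv (δl-iso₂ X Y Z) (δl-iso₁ X Y Z) (map-δl⁻¹ X Y Z)
  map-δr : ∀ X Y Z → Map (δr X Y Z)
  map-δr X Y Z = map-inv (δr-iso₂ X Y Z) (δr-iso₁ X Y Z) (map-δr⁻¹ X Y Z)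
  map-λ• : ∀ A → Map (λ• A)
  map-λ• A = from-O⊗-unique _ _ , from-O⊗-unique _ _
  map-ρ• : ∀ A → Map (ρ• A)
  map-ρ• A = from-⊗O-unique _ _ , from-⊗O-unique _ _

  mapClosed : MapClosed 𝒞
  mapClosed = record
    { catClosed = record { id-P = map-id ; ⨾-P = map-⨾ }
    ; timesClosed = record
      { ⊗-P = map-⊗
      ; α-P = map-α
      ; α⁻¹-P = λ A B D → map-inv (⊗.α-iso₁ A B D) (⊗.α-iso₂ A B D) (map-α A B D)
      ; lu-P = map-lu
      ; lu⁻¹-P = λ A → map-inv (⊗.lu-iso₁ A) (⊗.lu-iso₂ A) (map-lu A)
      ; ru-P = map-ru
      ; ru⁻¹-P = λ A → map-inv (⊗.ru-iso₁ A) (⊗.ru-iso₂ A) (map-ru A)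
      ; σ-P = map-σ
      }
    ; plusClosed = record
      { ⊗-P = map-⊕
      ; α-P = map-α⊕
      ; α⁻¹-P = λ A B D → map-inv (⊕.α-iso₁ A B D) (⊕.α-iso₂ A B D) (map-α⊕ A B D)
      ; lu-P = map-lu⊕
      ; lu⁻¹-P = λ A → map-inv (⊕.lu-iso₁ A) (⊕.lu-iso₂ A) (map-lu⊕ A)
      ; ru-P = map-ru⊕
      ; ru⁻¹-P = λ A → map-inv (⊕.ru-iso₁ A) (⊕.ru-iso₂ A) (map-ru⊕ A)
      ; σ-P = map-σ⊕
      }
    ; δl-P = map-δl
    ; δl⁻¹-P = map-δl⁻¹
    ; δr-P = map-δr
    ; δr⁻¹-P = map-δr⁻¹
    ; λ•-P = map-λ•
    ; λ•⁻¹-P = λ A → map-from-O _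
    ; ρ•-P = map-ρ•
    ; ρ•⁻¹-P = λ A → map-from-O _
    ; ∇-P = map-∇
    ; ¡-P = λ A → map-from-O _
    ; copy-P = map-copy
    ; disc-P = map-disc
    }

  map-isFcFpRig : IsFcFpRig (MapCat 𝒞 mapClosed) (MapOps 𝒞 mapClosed)
  map-isFcFpRig = record
    { isRig = restrictRigOps-isRig ops mapClosed isRig
    ; isFc = restrictRigOps-isFc ops mapClosed isFc
    ; isFp = record
      { isCd = restrictRigOps-isCd ops mapClosed isCd
      ; copy-nat = λ f → proj₁ (proj₂ f)
      ; disc-nat = λ f → proj₂ (proj₂ f)
      }
    }
    where open Restriction isCategory Map


  copy-disc-preserve-∇-¡ : ∀ X →
    (∇ X ⨾ copy X ≈ (copy X ⊕₁ copy X) ⨾ ∇ (X ⊗₀ X)) × (∇ X ⨾ disc X ≈ (disc X ⊕₁ disc X) ⨾ ∇ I)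
    × (¡ X ⨾ copy X ≈ ¡ (X ⊗₀ X)) × (¡ X ⨾ disc X ≈ ¡ I)
  copy-disc-preserve-∇-¡ X =
    sym (Fc.∇-nat (copy X)) , sym (Fc.∇-nat (disc X)) , Fc.¡-nat (copy X) , Fc.¡-nat (disc X)

  ∇-¡-deterministic-total : ∀ X → Det (∇ X) × Tot (∇ X) × Det (¡ X) × Tot (¡ X)
  ∇-¡-deterministic-total X = proj₁ (map-∇ X) , proj₂ (map-∇ X) , det-from-O (¡ X) , tot-from-O (¡ X)

proposition13 : ∀ {o h e : Level} (𝒞 : FcCdRigCategory o h e) →
    let open FcCdRigCategory 𝒞 in
    (∀ X → (∇ X ⨾ copy X ≈ (copy X ⊕₁ copy X) ⨾ ∇ (X ⊗₀ X))
         × (∇ X ⨾ disc X ≈ (disc X ⊕₁ disc X) ⨾ ∇ I)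
         × (¡ X ⨾ copy X ≈ ¡ (X ⊗₀ X))
         × (¡ X ⨾ disc X ≈ ¡ I))
    × (∀ X → Deterministic ops (∇ X) × Total ops (∇ X)
           × Deterministic ops (¡ X) × Total ops (¡ X))
    × MapIsFcFpRig 𝒞
proposition13 𝒞 = copy-disc-preserve-∇-¡ , ∇-¡-deterministic-total , (mapClosed , map-isFcFpRig)
  where open FcCdRig 𝒞
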